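{- Let $k\ge 2$, let $P_k$ be a path on $k$ vertices with pendent vertices $x$ and $y$, and let $H$ be a connected graph (vertex-disjoint from $P_k$). Let $G$ be the graph obtained from $P_k$ and $H$ by identifying a vertex of $P_k$ with a vertex of $H$; call the identified vertex $v$. Let $k_1=\mathrm{dist}_G(v,x)$ and $k_2=\mathrm{dist}_G(v,y)$. Then \[ \mathbf d_G^TF_G\mathbf d_G=\mathbf d_H^TF_H\mathbf d_H+4(k-1)\mathbf d_H^T\mathbf f^v_H+\tau_H\Big(\tfrac43(k-1)^3+\tfrac23(k-1)+4m_H(k_1^2+k_2^2)\Big). \]
   Context: All graphs are finite, simple and undirected. For a graph $G$: $\mathbf d_G$ is the column vector of vertex degrees; $m_G=|E(G)|$; $\tau_G$ is the number of spanning trees; $F_G=[f^G_{i,j}]$ where $f^G_{i,j}$ is the number of spanning forests of $G$ consisting of exactly two trees, one containing vertex $i$ and the other containing vertex $j$ ($f^G_{i,i}=0$); $\mathbf f^v_G$ is the column of $F_G$ indexed by the vertex $v$ (here $v$ is regarded as a vertex of $H$). -}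

module Defs where

open import Data.Bool using (Bool; true; false; _∧_; _∨_; not; if_then_else_)
open import Data.Nat using (ℕ; zero; suc; _+_; _*_; _∸_; _≡ᵇ_; _<ᵇ_)
open import Data.Fin using (Fin; toℕ; splitAt)
open import Data.List using (List; []; _∷_; map; filter; length; allFin; concatMap; foldr; _++_)
open import Data.Bool.ListAction using (all; any)
open import Data.Nat.ListAction using (sum)
open import Data.Maybe using (Maybe; just; nothing)
open import Data.Product using (_×_; _,_; proj₁; proj₂)
open import Data.Sum using (inj₁; inj₂)
open import Relation.Binary.PropositionalEquality using (_≡_)
open import Relation.Nullary.Decidable using (T?)
open import Data.Bool using (T)

Graph : ℕ → Set
Graph n = Fin n → Fin n → Bool

IsSimple : {n : ℕ} → Graph n → Set
IsSimple {n} A = ((i j : Fin n) → A i j ≡ A j i) × ((i : Fin n) → A i i ≡ false)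

_==_ : {n : ℕ} → Fin n → Fin n → Bool
i == j = toℕ i ≡ᵇ toℕ j

Edge : ℕ → Set
Edge n = Fin n × Fin n

edges : {n : ℕ} → Graph n → List (Edge n)
edges {n} A = filter (λ e → T? (((toℕ (proj₁ e)) <ᵇ (toℕ (proj₂ e))) ∧ A (proj₁ e) (proj₂ e)))
                (concatMap (λ i → map (λ j → (i , j)) (allFin n)) (allFin n))

numEdges : {n : ℕ} → Graph n → ℕ
numEdges A = length (edges A)

deg : {n : ℕ} → Graph n → Fin n → ℕ
deg {n} A i = length (filter (λ j → T? (A i j)) (allFin n))

subsets : {X : Set} → List X → List (List X)
subsets [] = [] ∷ []
subsets (x ∷ xs) = let r = subsets xs in map (x ∷_) r ++ r

picks : {X : Set} → List X → List (X × List X)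
picks [] = []
picks (x ∷ xs) = (x , xs) ∷ map (λ p → (proj₁ p , x ∷ proj₂ p)) (picks xs)

walkWithin : {n : ℕ} → List (Edge n) → ℕ → Fin n → Fin n → Bool
walkWithin S zero a b = a == b
walkWithin S (suc t) a b =
  walkWithin S t a b ∨
  any (λ e → (walkWithin S t a (proj₁ e) ∧ (proj₂ e == b)) ∨
             (walkWithin S t a (proj₂ e) ∧ (proj₁ e == b))) S

conn : {n : ℕ} → List (Edge n) → Fin n → Fin n → Bool
conn {n} S a b = walkWithin S n a b

connectedE : {n : ℕ} → List (Edge n) → Bool
connectedE {n} S = all (λ a → all (λ b → conn S a b) (allFin n)) (allFin n)

acyclic : {n : ℕ} → List (Edge n) → Bool
acyclic S = all (λ p → not (conn (proj₂ p) (proj₁ (proj₁ p)) (proj₂ (proj₁ p)))) (picks S)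

Connected : {n : ℕ} → Graph n → Set
Connected A = T (connectedE (edges A))

τ : {n : ℕ} → Graph n → ℕ
τ A = length (filter (λ S → T? (connectedE S ∧ acyclic S)) (subsets (edges A)))

twoForest : {n : ℕ} → List (Edge n) → Fin n → Fin n → Bool
twoForest {n} S i j = acyclic S ∧ not (conn S i j) ∧ all (λ u → conn S u i ∨ conn S u j) (allFin n)

f : {n : ℕ} → Graph n → Fin n → Fin n → ℕ
f A i j = length (filter (λ S → T? (twoForest S i j)) (subsets (edges A)))

Σ[_]_ : (n : ℕ) → (Fin n → ℕ) → ℕ
Σ[ n ] g = sum (map g (allFin n))

dFd : {n : ℕ} → Graph n → ℕ
dFd {n} A = Σ[ n ] (λ i → Σ[ n ] (λ j → deg A i * f A i j * deg A j))

dfv : {n : ℕ} → Graph n → Fin n → ℕ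
dfv {n} A v = Σ[ n ] (λ u → deg A u * f A u v)

-- The coalescence G of H (vertices Fin n) and the path P_k (positions 0..k-1,
-- x = position 0, y = position k-1), identifying v ∈ H with path position p.
-- Vertex set of G: Fin (n + (k ∸ 1)); the first n vertices are those of H,
-- the remaining k-1 are the path vertices other than position p, in order.
pathPos : {n k : ℕ} → Fin n → Fin k → Fin (n + (k ∸ 1)) → Maybe ℕ
pathPos {n} {k} v p u with splitAt n u
... | inj₁ a = if a == v then just (toℕ p) else nothing
... | inj₂ e = just (if toℕ e <ᵇ toℕ p then toℕ e else suc (toℕ e))

pathAdj : Maybe ℕ → Maybe ℕ → Bool
pathAdj (just a) (just b) = (suc a ≡ᵇ b) ∨ (suc b ≡ᵇ a)
pathAdj _ _ = false

hAdj : {n m : ℕ} → Graph n → Fin (n + m) → Fin (n + m) → Bool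
hAdj {n} A u w with splitAt n u | splitAt n w
... | inj₁ a | inj₁ b = A a b
... | _ | _ = false

coalesce : {n : ℕ} → Graph n → Fin n → (k : ℕ) → Fin k → Graph (n + (k ∸ 1))
coalesce {n} A v k p u w = hAdj A u w ∨ pathAdj (pathPos v p u) (pathPos v p w)

-- G is built from H by adding the path vertices one at a time, each as a new leaf at an end of
-- the path grown so far.  Attaching a leaf w to a vertex u of a graph G′ keeps the spanning trees,
-- and a spanning forest of two trees of the larger graph either contains the edge uw, and is then
-- such a forest of G′, or isolates w, and is then a spanning tree of G′.  Hence f(a, b) is
-- unchanged for old vertices a, b, while f(w, b) = τ + f(u, b), so dᵀ F d grows by
-- 4 dᵀ fᵘ + τ (4m + 2).  Tracking τ, m, f(x, y), dᵀ fˣ, dᵀ fʸ and dᵀ F d along the path gives the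
-- closed formula.

module Submission where

open import Defs
open import Data.Bool using (Bool; true; false; _∧_; _∨_; not; if_then_else_; T)
open import Data.Bool.Properties using (∨-comm; ∨-assoc; ∧-comm; ∧-assoc; ∨-identityʳ)
open import Data.Bool.ListAction using (all; any)
open import Data.Empty using (⊥-elim)
open import Data.Fin using (Fin; toℕ; zero; suc; splitAt; _↑ˡ_; _↑ʳ_; inject₁; fromℕ)
open import Data.Fin.Properties
  using (toℕ-injective; toℕ<n; splitAt-↑ˡ; splitAt-↑ʳ; splitAt⁻¹-↑ˡ; splitAt⁻¹-↑ʳ; toℕ-↑ˡ; toℕ-↑ʳ; toℕ-inject₁; toℕ-fromℕ)
open import Data.List
  using (List; []; _∷_; map; filter; length; allFin; _++_; concatMap; cartesianProduct)
open import Data.List.Properties using (map-++; map-∘; map-tabulate; length-map; length-tabulate)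
open import Data.List.Membership.Propositional using (_∈_; _∉_)
open import Data.List.Membership.Propositional.Properties
  using (∈-allFin; ∈-map⁺; ∈-map⁻; ∈-filter⁺; ∈-filter⁻; ∈-cartesianProduct⁺)
open import Data.List.Membership.Propositional.Properties.WithK using (unique∧set⇒bag)
open import Data.List.Relation.Binary.BagAndSetEquality using (∼bag⇒↭)
import Data.List.Relation.Binary.Permutation.Propositional as ↭
open ↭ using (_↭_; prep; swap; ↭-refl)
open import Data.List.Relation.Binary.Permutation.Propositional.Properties
  using (↭-length) renaming (map⁺ to ↭-map⁺)
open import Data.List.Relation.Unary.Any using (here; there)
open import Data.List.Relation.Unary.All.Properties using (¬Any⇒All¬)
open import Data.List.Relation.Unary.AllPairs using (_∷_)
open import Data.List.Relation.Unary.Unique.Propositional using (Unique)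
import Data.List.Relation.Unary.Unique.Propositional.Properties as Unique
open import Data.Maybe using (Maybe; just; nothing)
import Data.Maybe as Maybe
open import Data.Maybe.Properties using (just-injective)
open import Data.Nat
  using (ℕ; zero; suc; _+_; _*_; _∸_; _^_; _≤_; _<_; z≤n; s≤s; s≤s⁻¹; _≡ᵇ_; _<ᵇ_)
open import Data.Nat.Properties
open import Data.Nat.ListAction using (sum)
open import Data.Nat.ListAction.Properties using (sum-++; sum-↭)
open import Data.Nat.Tactic.RingSolver using (solve-∀)
open import Data.Product using (_×_; _,_; proj₁; proj₂; ∃; ∃-syntax)
import Data.Product as Product
open import Data.Sum using (_⊎_; inj₁; inj₂; [_,_]′)
import Data.Sum as Sum
open import Data.Unit using (tt)
open import Function using (_∘_)
open import Function.Bundles using (mk⇔)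
open import Relation.Binary using (tri<; tri≈; tri>)
open import Relation.Binary.PropositionalEquality
open import Relation.Nullary using (¬_; yes; no)
open import Relation.Nullary.Decidable using (T?)

T-ext : ∀ {a b : Bool} → (T a → T b) → (T b → T a) → a ≡ b
T-ext {false} {false} _ _ = refl
T-ext {false} {true}  _ g = ⊥-elim (g tt)
T-ext {true}  {false} f _ = ⊥-elim (f tt)
T-ext {true}  {true}  _ _ = refl

T-∧⁻ : ∀ {a b} → T (a ∧ b) → T a × T b
T-∧⁻ {true} {true} _ = tt , tt

T-∧⁺ : ∀ {a b} → T a → T b → T (a ∧ b)
T-∧⁺ {true} {true} _ _ = tt

T-∨⁻ : ∀ {a b} → T (a ∨ b) → T a ⊎ T b
T-∨⁻ {true}          _ = inj₁ tt
T-∨⁻ {false} {true}  _ = inj₂ tt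

T-∨ˡ : ∀ {a b} → T a → T (a ∨ b)
T-∨ˡ {true} _ = tt

T-∨ʳ : ∀ {a b} → T b → T (a ∨ b)
T-∨ʳ {true}  _ = tt
T-∨ʳ {false} p = p

T-not⁻ : ∀ {a} → T (not a) → ¬ T a
T-not⁻ {false} _ ()

T-not⁺ : ∀ {a} → ¬ T a → T (not a)
T-not⁺ {false} _ = tt
T-not⁺ {true}  f = f tt

==⇒≡ : ∀ {n} {i j : Fin n} → T (i == j) → i ≡ j
==⇒≡ {i = i} {j} p = toℕ-injective (≡ᵇ⇒≡ (toℕ i) (toℕ j) p)

≡⇒== : ∀ {n} {i j : Fin n} → i ≡ j → T (i == j)
≡⇒== {i = i} refl = ≡⇒≡ᵇ (toℕ i) (toℕ i) refl

==-refl : ∀ {n} (i : Fin n) → (i == i) ≡ true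
==-refl i = T-ext (λ _ → tt) (λ _ → ≡⇒== {i = i} refl)

<ᵇ-true : ∀ {a b} → (a <ᵇ b) ≡ true → a < b
<ᵇ-true {a} {b} eq = <ᵇ⇒< a b (subst T (sym eq) tt)

module _ {X : Set} where

  T-any⁻ : ∀ (p : X → Bool) xs → T (any p xs) → ∃ λ x → x ∈ xs × T (p x)
  T-any⁻ p (x ∷ xs) h with p x in eq
  ... | true = x , here refl , subst T (sym eq) tt
  ... | false with T-any⁻ p xs h
  ... | y , y∈xs , py = y , there y∈xs , py

  T-any⁺ : ∀ (p : X → Bool) {xs x} → x ∈ xs → T (p x) → T (any p xs)
  T-any⁺ p           (here refl) px = T-∨ˡ px
  T-any⁺ p {y ∷ _}   (there x∈)  px = T-∨ʳ {p y} (T-any⁺ p x∈ px)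

  T-all⁻ : ∀ (p : X → Bool) xs → T (all p xs) → ∀ {x} → x ∈ xs → T (p x)
  T-all⁻ p (y ∷ xs) h (here refl) = proj₁ (T-∧⁻ h)
  T-all⁻ p (y ∷ xs) h (there x∈)  = T-all⁻ p xs (proj₂ (T-∧⁻ {p y} h)) x∈

  T-all⁺ : ∀ (p : X → Bool) xs → (∀ {x} → x ∈ xs → T (p x)) → T (all p xs)
  T-all⁺ p []       _ = tt
  T-all⁺ p (x ∷ xs) f = T-∧⁺ (f (here refl)) (T-all⁺ p xs (f ∘ there))

  any-cong : ∀ {p q : X → Bool} xs → (∀ x → p x ≡ q x) → any p xs ≡ any q xs
  any-cong []       _ = refl
  any-cong (x ∷ xs) e = cong₂ _∨_ (e x) (any-cong xs e)

  all-cong : ∀ {p q : X → Bool} xs → (∀ x → p x ≡ q x) → all p xs ≡ all q xs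
  all-cong []       _ = refl
  all-cong (x ∷ xs) e = cong₂ _∧_ (e x) (all-cong xs e)

  all-map : ∀ {Y : Set} (p : Y → Bool) (g : X → Y) xs → all p (map g xs) ≡ all (p ∘ g) xs
  all-map p g []       = refl
  all-map p g (x ∷ xs) = cong (p (g x) ∧_) (all-map p g xs)

  any-↭ : ∀ (p : X → Bool) {xs ys} → xs ↭ ys → any p xs ≡ any p ys
  any-↭ p ↭.refl = refl
  any-↭ p (prep x q) = cong (p x ∨_) (any-↭ p q)
  any-↭ p {x ∷ y ∷ xs} {y ∷ x ∷ ys} (swap x y q) = begin
    p x ∨ (p y ∨ any p xs)  ≡⟨ ∨-assoc (p x) (p y) _ ⟨
    (p x ∨ p y) ∨ any p xs  ≡⟨ cong (_∨ any p xs) (∨-comm (p x) (p y)) ⟩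
    (p y ∨ p x) ∨ any p xs  ≡⟨ ∨-assoc (p y) (p x) _ ⟩
    p y ∨ (p x ∨ any p xs)  ≡⟨ cong (λ z → p y ∨ (p x ∨ z)) (any-↭ p q) ⟩
    p y ∨ (p x ∨ any p ys)  ∎
    where open ≡-Reasoning
  any-↭ p (↭.trans q r) = trans (any-↭ p q) (any-↭ p r)

𝟙 : Bool → ℕ
𝟙 true  = 1
𝟙 false = 0

sum-map-0 : ∀ {X : Set} (xs : List X) → sum (map (λ _ → 0) xs) ≡ 0
sum-map-0 []       = refl
sum-map-0 (_ ∷ xs) = sum-map-0 xs

module _ {X : Set} where

  length-filter : ∀ (p : X → Bool) xs → length (filter (λ y → T? (p y)) xs) ≡ sum (map (𝟙 ∘ p) xs)
  length-filter p [] = refl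
  length-filter p (x ∷ xs) with p x
  ... | true  = cong suc (length-filter p xs)
  ... | false = length-filter p xs

  sum-map-cong : ∀ {f g : X → ℕ} xs → (∀ x → f x ≡ g x) → sum (map f xs) ≡ sum (map g xs)
  sum-map-cong []       _ = refl
  sum-map-cong (x ∷ xs) e = cong₂ _+_ (e x) (sum-map-cong xs e)

  sum-map-+ : ∀ (f g : X → ℕ) xs → sum (map (λ x → f x + g x) xs) ≡ sum (map f xs) + sum (map g xs)
  sum-map-+ f g []       = refl
  sum-map-+ f g (x ∷ xs) = begin
    f x + g x + sum (map (λ x → f x + g x) xs)  ≡⟨ cong (f x + g x +_) (sum-map-+ f g xs) ⟩
    f x + g x + (F + G)                         ≡⟨ +-assoc (f x) (g x) (F + G) ⟩
    f x + (g x + (F + G))                       ≡⟨ cong (f x +_) (x+[y+z]≡y+[x+z] (g x) F G) ⟩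
    f x + (F + (g x + G))                       ≡⟨ +-assoc (f x) F (g x + G) ⟨
    f x + F + (g x + G)                         ∎
    where
    open ≡-Reasoning
    F G : ℕ
    F = sum (map f xs)
    G = sum (map g xs)
    x+[y+z]≡y+[x+z] : ∀ a b c → a + (b + c) ≡ b + (a + c)
    x+[y+z]≡y+[x+z] = solve-∀

  sum-map-*ˡ : ∀ (c : ℕ) (f : X → ℕ) xs → sum (map (λ x → c * f x) xs) ≡ c * sum (map f xs)
  sum-map-*ˡ c f []       = sym (*-zeroʳ c)
  sum-map-*ˡ c f (x ∷ xs) = trans (cong (c * f x +_) (sum-map-*ˡ c f xs)) (sym (*-distribˡ-+ c (f x) _))

  sum-map-∘ : ∀ {Y : Set} (f : Y → ℕ) (g : X → Y) xs → sum (map f (map g xs)) ≡ sum (map (f ∘ g) xs)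
  sum-map-∘ f g xs = cong sum (sym (map-∘ xs))

  sum-map-++ : ∀ (f : X → ℕ) xs ys → sum (map f (xs ++ ys)) ≡ sum (map f xs) + sum (map f ys)
  sum-map-++ f xs ys = trans (cong sum (map-++ f xs ys)) (sum-++ (map f xs) (map f ys))

sum-map-swap : ∀ {X Y : Set} (h : X → Y → ℕ) xs (ys : List Y) →
  sum (map (λ x → sum (map (h x) ys)) xs) ≡ sum (map (λ y → sum (map (λ x → h x y) xs)) ys)
sum-map-swap h []       ys = sym (sum-map-0 ys)
sum-map-swap h (x ∷ xs) ys =
  trans (cong (sum (map (h x) ys) +_) (sum-map-swap h xs ys)) (sym (sum-map-+ (h x) _ ys))

Σ-suc : ∀ n (g : Fin (suc n) → ℕ) → Σ[ suc n ] g ≡ g zero + Σ[ n ] (g ∘ suc)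
Σ-suc n g = cong (g zero +_) (cong sum (trans (map-tabulate suc g) (sym (map-tabulate (λ i → i) (g ∘ suc)))))

Σ-𝟙== : ∀ n (u : Fin n) (h : Fin n → ℕ) → Σ[ n ] (λ j → 𝟙 (j == u) * h j) ≡ h u
Σ-𝟙== (suc n) zero h = begin
  Σ[ suc n ] (λ j → 𝟙 (j == zero) * h j)  ≡⟨ Σ-suc n (λ j → 𝟙 (j == zero) * h j) ⟩
  h zero + 0 + Σ[ n ] (λ _ → 0)           ≡⟨ cong₂ _+_ (+-identityʳ (h zero)) (sum-map-0 (allFin n)) ⟩
  h zero + 0                              ≡⟨ +-identityʳ (h zero) ⟩
  h zero                                  ∎
  where open ≡-Reasoning
Σ-𝟙== (suc n) (suc u) h = trans (Σ-suc n (λ j → 𝟙 (j == suc u) * h j)) (Σ-𝟙== n u (h ∘ suc))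

-- Walks and connectivity

module Walks {n : ℕ} (S : List (Edge n)) where

  Adjacent : Fin n → Fin n → Set
  Adjacent c b = (c , b) ∈ S ⊎ (b , c) ∈ S

  Walk≤ : ℕ → Fin n → Fin n → Set
  Walk≤ t a b = T (walkWithin S t a b)

  Walk≤-suc⁻ : ∀ t a b → Walk≤ (suc t) a b → Walk≤ t a b ⊎ ∃[ c ] (Walk≤ t a c × Adjacent c b)
  Walk≤-suc⁻ t a b h with T-∨⁻ {walkWithin S t a b} h
  ... | inj₁ short = inj₁ short
  ... | inj₂ step with T-any⁻ _ S step
  ... | (e₁ , e₂) , e∈S , last with T-∨⁻ {walkWithin S t a e₁ ∧ (e₂ == b)} last
  ... | inj₁ forward with T-∧⁻ {walkWithin S t a e₁} forward
  ...   | walk , e₂==b with ==⇒≡ {i = e₂} e₂==b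
  ...   | refl = inj₂ (e₁ , walk , inj₁ e∈S)
  Walk≤-suc⁻ t a b h | inj₂ step | (e₁ , e₂) , e∈S , last | inj₂ backward
    with T-∧⁻ {walkWithin S t a e₂} backward
  ...   | walk , e₁==b with ==⇒≡ {i = e₁} e₁==b
  ...   | refl = inj₂ (e₂ , walk , inj₂ e∈S)

  Walk≤-suc⁺ : ∀ t a b → Walk≤ t a b → Walk≤ (suc t) a b
  Walk≤-suc⁺ t a b h = T-∨ˡ h

  Walk≤-+ : ∀ s t a b → Walk≤ t a b → Walk≤ (s + t) a b
  Walk≤-+ zero    t a b h = h
  Walk≤-+ (suc s) t a b h = Walk≤-suc⁺ (s + t) a b (Walk≤-+ s t a b h)

  Walk≤-step : ∀ t a c b → Walk≤ t a c → Adjacent c b → Walk≤ (suc t) a b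
  Walk≤-step t a c b h (inj₁ cb∈S) =
    T-∨ʳ {walkWithin S t a b} (T-any⁺ _ cb∈S (T-∨ˡ (T-∧⁺ h (≡⇒== {i = b} refl))))
  Walk≤-step t a c b h (inj₂ bc∈S) =
    T-∨ʳ {walkWithin S t a b} (T-any⁺ _ bc∈S (T-∨ʳ {walkWithin S t a b ∧ (c == b)} (T-∧⁺ h (≡⇒== {i = b} refl))))

  Reachable : Fin n → Fin n → Set
  Reachable a b = ∃[ t ] Walk≤ t a b

  Reachable-refl : ∀ a → Reachable a a
  Reachable-refl a = 0 , ≡⇒== {i = a} refl

  Reachable-step : ∀ {a c b} → Reachable a c → Adjacent c b → Reachable a b
  Reachable-step {a} {c} {b} (t , h) c~b = suc t , Walk≤-step t a c b h c~b

  Reachable-elim : ∀ {a} (P : Fin n → Set) → P a → (∀ {c b} → P c → Adjacent c b → P b) →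
                   ∀ {b} → Reachable a b → P b
  Reachable-elim {a} P Pa step (t , h) = go t _ h
    where
    go : ∀ t b → Walk≤ t a b → P b
    go zero b h with ==⇒≡ {i = a} h
    ... | refl = Pa
    go (suc t) b h with Walk≤-suc⁻ t a b h
    ... | inj₁ short            = go t b short
    ... | inj₂ (c , walk , c~b) = step (go t c walk) c~b

  Reachable-trans : ∀ {a c b} → Reachable a c → Reachable c b → Reachable a b
  Reachable-trans {a} r = Reachable-elim (Reachable a) r Reachable-step

  Reachable-sym : ∀ {a b} → Reachable a b → Reachable b a
  Reachable-sym {a} = Reachable-elim (λ x → Reachable x a) (Reachable-refl a)
    (λ {c} {b} b→a c~b → Reachable-trans (Reachable-step (Reachable-refl b) (Sum.swap c~b)) b→a)

  count : (Fin n → Bool) → List (Fin n) → ℕ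
  count X xs = length (filter (λ y → T? (X y)) xs)

  count-≤-length : ∀ X xs → count X xs ≤ length xs
  count-≤-length X [] = z≤n
  count-≤-length X (x ∷ xs) with X x
  ... | true  = s≤s (count-≤-length X xs)
  ... | false = m≤n⇒m≤1+n (count-≤-length X xs)

  count-mono : ∀ X Y → (∀ b → T (X b) → T (Y b)) → ∀ xs → count X xs ≤ count Y xs
  count-mono X Y X⊆Y [] = z≤n
  count-mono X Y X⊆Y (x ∷ xs) with X x in ex | Y x in ey
  ... | true  | true  = s≤s (count-mono X Y X⊆Y xs)
  ... | true  | false = ⊥-elim (subst T ey (X⊆Y x (subst T (sym ex) tt)))
  ... | false | true  = m≤n⇒m≤1+n (count-mono X Y X⊆Y xs)
  ... | false | false = count-mono X Y X⊆Y xs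

  count-strict : ∀ X Y → (∀ b → T (X b) → T (Y b)) → ∀ xs b → b ∈ xs → T (Y b) → ¬ T (X b) →
                 count X xs < count Y xs
  count-strict X Y X⊆Y (x ∷ xs) b (here refl) Yb ¬Xb with X x in ex | Y x in ey
  ... | true  | _     = ⊥-elim (¬Xb tt)
  ... | false | false = ⊥-elim Yb
  ... | false | true  = s≤s (count-mono X Y X⊆Y xs)
  count-strict X Y X⊆Y (x ∷ xs) b (there b∈) Yb ¬Xb with X x in ex | Y x in ey
  ... | true  | true  = s≤s (count-strict X Y X⊆Y xs b b∈ Yb ¬Xb)
  ... | true  | false = ⊥-elim (subst T ey (X⊆Y x (subst T (sym ex) tt)))
  ... | false | true  = m≤n⇒m≤1+n (count-strict X Y X⊆Y xs b b∈ Yb ¬Xb)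
  ... | false | false = count-strict X Y X⊆Y xs b b∈ Yb ¬Xb

  count-false : ∀ xs → count (λ _ → false) xs ≡ 0
  count-false []       = refl
  count-false (_ ∷ xs) = count-false xs

  -- The ball of radius t around a grows strictly until it stops growing for good,
  -- and it has at most n elements; hence walks of length n already reach everything.
  module Saturation (a : Fin n) where

    ball : ℕ → Fin n → Bool
    ball t = walkWithin S t a

    ballSize : ℕ → ℕ
    ballSize t = count (ball t) (allFin n)

    Stable : ℕ → Set
    Stable t = ∀ b → Walk≤ (suc t) a b → Walk≤ t a b

    stable⇒saturated : ∀ t → Stable t → ∀ s b → Walk≤ (s + t) a b → Walk≤ t a b
    stable⇒saturated t st zero    b h = h
    stable⇒saturated t st (suc s) b h with Walk≤-suc⁻ (s + t) a b h
    ... | inj₁ short            = stable⇒saturated t st s b short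
    ... | inj₂ (c , walk , c~b) = st b (Walk≤-step t a c b (stable⇒saturated t st s c walk) c~b)

    find-new : ∀ t xs → ¬ T (all (λ b → not (ball (suc t) b) ∨ ball t b) xs) →
               ∃[ b ] (T (ball (suc t) b) × ¬ T (ball t b))
    find-new t []       h = ⊥-elim (h tt)
    find-new t (x ∷ xs) h with T? (ball (suc t) x) | T? (ball t x)
    ... | yes new | no  old = x , new , old
    ... | yes _   | yes old = find-new t xs (λ q → h (T-∧⁺ (T-∨ʳ {not (ball (suc t) x)} old) q))
    ... | no  new | _       = find-new t xs (λ q → h (T-∧⁺ (T-∨ˡ (T-not⁺ new)) q))

    stable-or-growing : ∀ t → (∃[ t′ ] (t′ ≤ t × Stable t′)) ⊎ suc t ≤ ballSize t
    stable-or-growing zero = inj₂ (subst (λ z → suc z ≤ ballSize 0) (count-false (allFin n))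
      (count-strict (λ _ → false) (ball 0) (λ _ ()) (allFin n) a (∈-allFin a) (proj₂ (Reachable-refl a)) (λ ())))
    stable-or-growing (suc t) with stable-or-growing t
    ... | inj₁ (t′ , t′≤t , st) = inj₁ (t′ , m≤n⇒m≤1+n t′≤t , st)
    ... | inj₂ grown with T? (all (λ b → not (ball (suc t) b) ∨ ball t b) (allFin n))
    ... | yes same = inj₁ (t , n≤1+n t , λ b h → old b h (T-∨⁻ {not (ball (suc t) b)} (T-all⁻ _ (allFin n) same (∈-allFin b))))
      where
      old : ∀ b → Walk≤ (suc t) a b → T (not (ball (suc t) b)) ⊎ T (ball t b) → Walk≤ t a b
      old b h (inj₁ notNew) = ⊥-elim (T-not⁻ notNew h)
      old b h (inj₂ wasOld) = wasOld
    ... | no differ with find-new t (allFin n) differ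
    ...   | b , new , notOld = inj₂ (≤-trans (s≤s grown)
            (count-strict (ball t) (ball (suc t)) (λ b → Walk≤-suc⁺ t a b) (allFin n) b (∈-allFin b) new notOld))

    Walk≤-saturate : ∀ t b → Walk≤ t a b → Walk≤ n a b
    Walk≤-saturate t b h with stable-or-growing n
    ... | inj₂ tooBig = ⊥-elim (<⇒≱ tooBig (subst (ballSize n ≤_) (length-tabulate {n = n} (λ i → i)) (count-≤-length (ball n) (allFin n))))
    ... | inj₁ (t′ , t′≤n , st) = subst (λ z → Walk≤ z a b) (m∸n+n≡m t′≤n)
          (Walk≤-+ (n ∸ t′) t′ a b (stable⇒saturated t′ st t b (subst (λ z → Walk≤ z a b) (+-comm t′ t) (Walk≤-+ t′ t a b h))))

  conn⇒Reachable : ∀ {a b} → T (conn S a b) → Reachable a b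
  conn⇒Reachable h = n , h

  Reachable⇒conn : ∀ {a b} → Reachable a b → T (conn S a b)
  Reachable⇒conn {a} {b} (t , h) = Saturation.Walk≤-saturate a t b h

open Walks using (Adjacent; Reachable; Reachable-refl; Reachable-step; Reachable-elim;
                         Reachable-trans; Reachable-sym; conn⇒Reachable; Reachable⇒conn)

module _ {n : ℕ} (S : List (Edge n)) where

  conn-refl : ∀ z → conn S z z ≡ true
  conn-refl z = T-ext (λ _ → tt) (λ _ → Reachable⇒conn S (Reachable-refl S z))

  conn-sym : ∀ a b → conn S a b ≡ conn S b a
  conn-sym a b = T-ext flip flip
    where
    flip : ∀ {x y} → T (conn S x y) → T (conn S y x)
    flip = Reachable⇒conn S ∘ Reachable-sym S ∘ conn⇒Reachable S

  connectedE⁻ : T (connectedE S) → ∀ a b → T (conn S a b)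
  connectedE⁻ h a b = T-all⁻ _ (allFin n) (T-all⁻ _ (allFin n) h (∈-allFin a)) (∈-allFin b)

  connectedE⁺ : (∀ a b → T (conn S a b)) → T (connectedE S)
  connectedE⁺ h = T-all⁺ _ (allFin n) (λ {a} _ → T-all⁺ _ (allFin n) (λ {b} _ → h a b))

  TwoForest : Fin n → Fin n → Set
  TwoForest i j = T (acyclic S) × ¬ T (conn S i j) × (∀ z → T (conn S z i) ⊎ T (conn S z j))

  twoForest⁻ : ∀ i j → T (twoForest S i j) → TwoForest i j
  twoForest⁻ i j h with T-∧⁻ {acyclic S} h
  ... | acyc , rest with T-∧⁻ {not (conn S i j)} rest
  ... | apart , covered = acyc , T-not⁻ apart , λ z → T-∨⁻ {conn S z i} (T-all⁻ _ (allFin n) covered (∈-allFin z))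

  twoForest⁺ : ∀ i j → TwoForest i j → T (twoForest S i j)
  twoForest⁺ i j (acyc , apart , covered) =
    T-∧⁺ acyc (T-∧⁺ (T-not⁺ apart) (T-all⁺ _ (allFin n) (λ {z} _ → Sum.[ T-∨ˡ , T-∨ʳ {conn S z i} ] (covered z))))

  twoForest-diag : ∀ z → twoForest S z z ≡ false
  twoForest-diag z = T-ext (λ h → proj₁ (proj₂ (twoForest⁻ z z h)) (subst T (sym (conn-refl z)) tt)) λ ()

  twoForest-sym : ∀ i j → twoForest S i j ≡ twoForest S j i
  twoForest-sym i j = T-ext (flip i j) (flip j i)
    where
    flip : ∀ i j → T (twoForest S i j) → T (twoForest S j i)
    flip i j h with twoForest⁻ i j h
    ... | acyc , apart , covered =
      twoForest⁺ j i (acyc , apart ∘ subst T (conn-sym j i) , Sum.swap ∘ covered)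

-- Counting edge subsets

countSubsets : ∀ {X : Set} → (List X → Bool) → List X → ℕ
countSubsets P L = sum (map (𝟙 ∘ P) (subsets L))

module _ {X : Set} where

  length-filter-subsets : ∀ (P : List X → Bool) L →
    length (filter (λ S → T? (P S)) (subsets L)) ≡ countSubsets P L
  length-filter-subsets P L = length-filter P (subsets L)

  countSubsets-∷ : ∀ (P : List X → Bool) x L →
    countSubsets P (x ∷ L) ≡ countSubsets (λ S → P (x ∷ S)) L + countSubsets P L
  countSubsets-∷ P x L = trans (sum-map-++ (𝟙 ∘ P) (map (x ∷_) (subsets L)) (subsets L))
    (cong (_+ countSubsets P L) (sum-map-∘ (𝟙 ∘ P) (x ∷_) (subsets L)))

  countSubsets-cong : ∀ {P Q : List X → Bool} L → (∀ S → P S ≡ Q S) → countSubsets P L ≡ countSubsets Q L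
  countSubsets-cong L e = sum-map-cong (subsets L) (cong 𝟙 ∘ e)

  countSubsets-false : ∀ (L : List X) → countSubsets (λ _ → false) L ≡ 0
  countSubsets-false L = sum-map-0 (subsets L)

  subsets-map : ∀ {Y : Set} (g : X → Y) L → subsets (map g L) ≡ map (map g) (subsets L)
  subsets-map g []      = refl
  subsets-map g (x ∷ L) rewrite subsets-map g L =
    trans (cong (_++ map (map g) (subsets L)) (trans (sym (map-∘ (subsets L))) (map-∘ (subsets L))))
          (sym (map-++ (map g) (map (x ∷_) (subsets L)) (subsets L)))

  countSubsets-map : ∀ {Y : Set} (P : List Y → Bool) (g : X → Y) L →
    countSubsets P (map g L) ≡ countSubsets (P ∘ map g) L
  countSubsets-map P g L rewrite subsets-map g L = sum-map-∘ (𝟙 ∘ P) (map g) (subsets L)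

  Invariant↭ : (List X → Bool) → Set
  Invariant↭ P = ∀ {S S′} → S ↭ S′ → P S ≡ P S′

  countSubsets-↭ : ∀ {L L′} → L ↭ L′ → (P : List X → Bool) → Invariant↭ P → countSubsets P L ≡ countSubsets P L′
  countSubsets-↭ ↭.refl P inv = refl
  countSubsets-↭ {x ∷ L} {x ∷ L′} (prep x p) P inv = begin
    countSubsets P (x ∷ L)                                     ≡⟨ countSubsets-∷ P x L ⟩
    countSubsets (λ S → P (x ∷ S)) L + countSubsets P L        ≡⟨ cong₂ _+_ (countSubsets-↭ p _ (inv ∘ prep x)) (countSubsets-↭ p P inv) ⟩
    countSubsets (λ S → P (x ∷ S)) L′ + countSubsets P L′      ≡⟨ countSubsets-∷ P x L′ ⟨
    countSubsets P (x ∷ L′)                                    ∎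
    where open ≡-Reasoning
  countSubsets-↭ {x ∷ y ∷ L} {y ∷ x ∷ L′} (swap x y p) P inv = begin
    countSubsets P (x ∷ y ∷ L)
      ≡⟨ countSubsets-∷ P x (y ∷ L) ⟩
    countSubsets (λ S → P (x ∷ S)) (y ∷ L) + countSubsets P (y ∷ L)
      ≡⟨ cong₂ _+_ (countSubsets-∷ (λ S → P (x ∷ S)) y L) (countSubsets-∷ P y L) ⟩
    (count (λ S → P (x ∷ y ∷ S)) L + count (λ S → P (x ∷ S)) L) + (count (λ S → P (y ∷ S)) L + count P L)
      ≡⟨ cong₂ _+_ (cong₂ _+_ xy eˣ) (cong₂ _+_ eʸ e) ⟩
    (count (λ S → P (y ∷ x ∷ S)) L′ + count (λ S → P (x ∷ S)) L′) + (count (λ S → P (y ∷ S)) L′ + count P L′)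
      ≡⟨ interchange (count (λ S → P (y ∷ x ∷ S)) L′) (count (λ S → P (x ∷ S)) L′) (count (λ S → P (y ∷ S)) L′) (count P L′) ⟩
    (count (λ S → P (y ∷ x ∷ S)) L′ + count (λ S → P (y ∷ S)) L′) + (count (λ S → P (x ∷ S)) L′ + count P L′)
      ≡⟨ cong₂ _+_ (countSubsets-∷ (λ S → P (y ∷ S)) x L′) (countSubsets-∷ P x L′) ⟨
    countSubsets (λ S → P (y ∷ S)) (x ∷ L′) + countSubsets P (x ∷ L′)
      ≡⟨ countSubsets-∷ P y (x ∷ L′) ⟨
    countSubsets P (y ∷ x ∷ L′)
      ∎
    where
    open ≡-Reasoning
    count : (List X → Bool) → List X → ℕ
    count = countSubsets
    xy : count (λ S → P (x ∷ y ∷ S)) L ≡ count (λ S → P (y ∷ x ∷ S)) L′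
    xy = trans (countSubsets-↭ p _ (inv ∘ prep x ∘ prep y)) (countSubsets-cong L′ (λ _ → inv (swap x y ↭-refl)))
    eˣ : count (λ S → P (x ∷ S)) L ≡ count (λ S → P (x ∷ S)) L′
    eˣ = countSubsets-↭ p (λ S → P (x ∷ S)) (inv ∘ prep x)
    eʸ : count (λ S → P (y ∷ S)) L ≡ count (λ S → P (y ∷ S)) L′
    eʸ = countSubsets-↭ p (λ S → P (y ∷ S)) (inv ∘ prep y)
    e : count P L ≡ count P L′
    e = countSubsets-↭ p P inv
    interchange : ∀ a b c d → (a + b) + (c + d) ≡ (a + c) + (b + d)
    interchange = solve-∀
  countSubsets-↭ (↭.trans p q) P inv = trans (countSubsets-↭ p P inv) (countSubsets-↭ q P inv)

isTree : ∀ {n} → List (Edge n) → Bool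
isTree S = connectedE S ∧ acyclic S

module _ {n : ℕ} where

  walkWithin-↭ : ∀ {S S′ : List (Edge n)} → S ↭ S′ → ∀ t a b → walkWithin S t a b ≡ walkWithin S′ t a b
  walkWithin-↭ q zero    a b = refl
  walkWithin-↭ {S} q (suc t) a b = cong₂ _∨_ (walkWithin-↭ q t a b)
    (trans (any-cong S (λ e → cong₂ _∨_ (cong (_∧ _) (walkWithin-↭ q t a (proj₁ e))) (cong (_∧ _) (walkWithin-↭ q t a (proj₂ e)))))
           (any-↭ _ q))

  conn-↭ : ∀ {S S′ : List (Edge n)} → S ↭ S′ → ∀ a b → conn S a b ≡ conn S′ a b
  conn-↭ q = walkWithin-↭ q n

  connectedE-↭ : Invariant↭ (connectedE {n})
  connectedE-↭ q = all-cong (allFin n) (λ a → all-cong (allFin n) (conn-↭ q a))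

  all-picks-↭ : ∀ (Q : Edge n × List (Edge n) → Bool) → (∀ e {R R′} → R ↭ R′ → Q (e , R) ≡ Q (e , R′)) →
                ∀ {L L′} → L ↭ L′ → all Q (picks L) ≡ all Q (picks L′)
  all-picks-↭ Q inv ↭.refl = refl
  all-picks-↭ Q inv {x ∷ L} {x ∷ L′} (prep x q) = cong₂ _∧_ (inv x q)
    (trans (all-map Q _ (picks L)) (trans (all-picks-↭ _ (λ e → inv e ∘ prep x) q) (sym (all-map Q _ (picks L′)))))
  all-picks-↭ Q inv {x ∷ y ∷ L} {y ∷ x ∷ L′} (swap x y q) = begin
    Q (x , y ∷ L) ∧ all Q (map (cons x) (picks (y ∷ L)))
      ≡⟨ cong (Q (x , y ∷ L) ∧_) (all-map Q (cons x) (picks (y ∷ L))) ⟩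
    Q (x , y ∷ L) ∧ (Q (y , x ∷ L) ∧ all (Q ∘ cons x) (map (cons y) (picks L)))
      ≡⟨ cong (λ z → Q (x , y ∷ L) ∧ (Q (y , x ∷ L) ∧ z)) (all-map (Q ∘ cons x) (cons y) (picks L)) ⟩
    Q (x , y ∷ L) ∧ (Q (y , x ∷ L) ∧ all (Q ∘ cons x ∘ cons y) (picks L))
      ≡⟨ cong (λ z → Q (x , y ∷ L) ∧ (Q (y , x ∷ L) ∧ z)) (all-picks-↭ _ (λ e → inv e ∘ prep x ∘ prep y) q) ⟩
    Q (x , y ∷ L) ∧ (Q (y , x ∷ L) ∧ all (Q ∘ cons x ∘ cons y) (picks L′))
      ≡⟨ cong (λ z → Q (x , y ∷ L) ∧ (Q (y , x ∷ L) ∧ z)) (all-cong (picks L′) (λ p → inv (proj₁ p) (swap x y ↭-refl))) ⟩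
    Q (x , y ∷ L) ∧ (Q (y , x ∷ L) ∧ all (Q ∘ cons y ∘ cons x) (picks L′))
      ≡⟨ cong₂ (λ a b → a ∧ (b ∧ all (Q ∘ cons y ∘ cons x) (picks L′))) (inv x (prep y q)) (inv y (prep x q)) ⟩
    Q (x , y ∷ L′) ∧ (Q (y , x ∷ L′) ∧ all (Q ∘ cons y ∘ cons x) (picks L′))
      ≡⟨ ∧-exchange (Q (x , y ∷ L′)) (Q (y , x ∷ L′)) _ ⟩
    Q (y , x ∷ L′) ∧ (Q (x , y ∷ L′) ∧ all (Q ∘ cons y ∘ cons x) (picks L′))
      ≡⟨ cong (λ z → Q (y , x ∷ L′) ∧ (Q (x , y ∷ L′) ∧ z)) (all-map (Q ∘ cons y) (cons x) (picks L′)) ⟨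
    Q (y , x ∷ L′) ∧ (Q (x , y ∷ L′) ∧ all (Q ∘ cons y) (map (cons x) (picks L′)))
      ≡⟨ cong (Q (y , x ∷ L′) ∧_) (all-map Q (cons y) (picks (x ∷ L′))) ⟨
    Q (y , x ∷ L′) ∧ all Q (map (cons y) (picks (x ∷ L′)))
      ∎
    where
    open ≡-Reasoning
    cons : Edge n → Edge n × List (Edge n) → Edge n × List (Edge n)
    cons z p = proj₁ p , z ∷ proj₂ p
    ∧-exchange : ∀ a b c → a ∧ (b ∧ c) ≡ b ∧ (a ∧ c)
    ∧-exchange a b c = trans (sym (∧-assoc a b c)) (trans (cong (_∧ c) (∧-comm a b)) (∧-assoc b a c))
  all-picks-↭ Q inv (↭.trans q q′) = trans (all-picks-↭ Q inv q) (all-picks-↭ Q inv q′)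

  acyclic-↭ : Invariant↭ (acyclic {n})
  acyclic-↭ = all-picks-↭ _ (λ e q → cong not (conn-↭ q (proj₁ e) (proj₂ e)))

  twoForest-↭ : ∀ i j → Invariant↭ (λ S → twoForest {n} S i j)
  twoForest-↭ i j q = cong₂ _∧_ (acyclic-↭ q) (cong₂ _∧_ (cong not (conn-↭ q i j))
    (all-cong (allFin n) (λ z → cong₂ _∨_ (conn-↭ q z i) (conn-↭ q z j))))

  isTree-↭ : Invariant↭ (isTree {n})
  isTree-↭ q = cong₂ _∧_ (connectedE-↭ q) (acyclic-↭ q)

unique-↭ : ∀ {X : Set} {xs ys : List X} → Unique xs → Unique ys →
           (∀ {z} → z ∈ xs → z ∈ ys) → (∀ {z} → z ∈ ys → z ∈ xs) → xs ↭ ys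
unique-↭ ux uy to from = ∼bag⇒↭ (unique∧set⇒bag ux uy (mk⇔ to from))

concatMap-pairs : ∀ {X Y : Set} (xs : List X) (ys : List Y) →
  concatMap (λ i → map (i ,_) ys) xs ≡ cartesianProduct xs ys
concatMap-pairs []       ys = refl
concatMap-pairs (x ∷ xs) ys = cong (map (x ,_) ys ++_) (concatMap-pairs xs ys)

module _ {n : ℕ} (A : Graph n) where

  private
    isEdge : Edge n → Bool
    isEdge e = (toℕ (proj₁ e) <ᵇ toℕ (proj₂ e)) ∧ A (proj₁ e) (proj₂ e)

    edges≡ : edges A ≡ filter (λ e → T? (isEdge e)) (cartesianProduct (allFin n) (allFin n))
    edges≡ = cong (filter (λ e → T? (isEdge e))) (concatMap-pairs (allFin n) (allFin n))

  edges-unique : Unique (edges A)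
  edges-unique = subst Unique (sym edges≡)
    (Unique.filter⁺ (λ e → T? (isEdge e)) (Unique.cartesianProduct⁺ (Unique.allFin⁺ n) (Unique.allFin⁺ n)))

  ∈-edges⁻ : ∀ {a b} → (a , b) ∈ edges A → toℕ a < toℕ b × T (A a b)
  ∈-edges⁻ {a} {b} ab∈ with T-∧⁻ {toℕ a <ᵇ toℕ b}
    (proj₂ (∈-filter⁻ (λ e → T? (isEdge e)) {xs = cartesianProduct (allFin n) (allFin n)} (subst ((a , b) ∈_) edges≡ ab∈)))
  ... | a<b , a~b = <ᵇ⇒< (toℕ a) (toℕ b) a<b , a~b

  ∈-edges⁺ : ∀ {a b} → toℕ a < toℕ b → T (A a b) → (a , b) ∈ edges A
  ∈-edges⁺ {a} {b} a<b a~b = subst ((a , b) ∈_) (sym edges≡)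
    (∈-filter⁺ (λ e → T? (isEdge e)) (∈-cartesianProduct⁺ (∈-allFin a) (∈-allFin b)) (T-∧⁺ (<⇒<ᵇ a<b) a~b))

τ-countSubsets : ∀ {n} (A : Graph n) → τ A ≡ countSubsets isTree (edges A)
τ-countSubsets A = length-filter-subsets isTree (edges A)

f-countSubsets : ∀ {n} (A : Graph n) i j → f A i j ≡ countSubsets (λ S → twoForest S i j) (edges A)
f-countSubsets A i j = length-filter-subsets (λ S → twoForest S i j) (edges A)

deg-Σ : ∀ {n} (A : Graph n) i → deg A i ≡ Σ[ n ] (𝟙 ∘ A i)
deg-Σ {n} A i = length-filter (A i) (allFin n)

f-sym : ∀ {n} (A : Graph n) i j → f A i j ≡ f A j i
f-sym A i j = trans (f-countSubsets A i j)
  (trans (countSubsets-cong (edges A) (λ S → twoForest-sym S i j)) (sym (f-countSubsets A j i)))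

f-diag : ∀ {n} (A : Graph n) z → f A z z ≡ 0
f-diag A z = trans (f-countSubsets A z z)
  (trans (countSubsets-cong (edges A) (λ S → twoForest-diag S z)) (countSubsets-false (edges A)))

dFd-dfv : ∀ {n} (A : Graph n) → dFd A ≡ Σ[ n ] (λ i → deg A i * dfv A i)
dFd-dfv {n} A = sum-map-cong (allFin n) λ i →
  trans (sum-map-cong (allFin n) (λ j → trans (cong (λ z → deg A i * z * deg A j) (f-sym A i j)) (reorder (deg A i) (f A j i) (deg A j))))
        (sum-map-*ˡ (deg A i) (λ j → deg A j * f A j i) (allFin n))
  where
  reorder : ∀ a b c → a * b * c ≡ a * (c * b)
  reorder = solve-∀

sum-concatMap-pairs : ∀ {X Y : Set} (h : X × Y → ℕ) (xs : List X) (ys : List Y) →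
  sum (map h (concatMap (λ i → map (i ,_) ys) xs)) ≡ sum (map (λ i → sum (map (λ j → h (i , j)) ys)) xs)
sum-concatMap-pairs h []       ys = refl
sum-concatMap-pairs h (x ∷ xs) ys = trans (sum-map-++ h (map (x ,_) ys) _)
  (cong₂ _+_ (sum-map-∘ h (x ,_) ys) (sum-concatMap-pairs h xs ys))

module _ {n : ℕ} (A : Graph n) (simple : IsSimple A) where

  private
    below above : Fin n → Fin n → ℕ
    below i j = 𝟙 ((toℕ i <ᵇ toℕ j) ∧ A i j)
    above i j = 𝟙 ((toℕ j <ᵇ toℕ i) ∧ A i j)

  numEdges-Σ : numEdges A ≡ Σ[ n ] (λ i → Σ[ n ] (below i))
  numEdges-Σ = trans (length-filter _ (concatMap (λ i → map (i ,_) (allFin n)) (allFin n)))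
                     (sum-concatMap-pairs (λ e → below (proj₁ e) (proj₂ e)) (allFin n) (allFin n))

  𝟙-adj-split : ∀ i j → 𝟙 (A i j) ≡ below i j + above i j
  𝟙-adj-split i j with toℕ i <ᵇ toℕ j in e₁ | toℕ j <ᵇ toℕ i in e₂
  ... | true  | true  = ⊥-elim (<-asym (<ᵇ-true {toℕ i} e₁) (<ᵇ-true {toℕ j} e₂))
  ... | true  | false = sym (+-identityʳ (𝟙 (A i j)))
  ... | false | true  = refl
  ... | false | false with <-cmp (toℕ i) (toℕ j)
  ...   | tri< i<j _ _ = ⊥-elim (subst T e₁ (<⇒<ᵇ i<j))
  ...   | tri> _ _ j<i = ⊥-elim (subst T e₂ (<⇒<ᵇ j<i))
  ...   | tri≈ _ i≡j _ rewrite toℕ-injective i≡j | proj₂ simple j = refl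

  handshake : Σ[ n ] (deg A) ≡ 2 * numEdges A
  handshake = begin
    Σ[ n ] (deg A)
      ≡⟨ sum-map-cong (allFin n) (deg-Σ A) ⟩
    Σ[ n ] (λ i → Σ[ n ] (𝟙 ∘ A i))
      ≡⟨ sum-map-cong (allFin n) (λ i → trans (sum-map-cong (allFin n) (𝟙-adj-split i)) (sum-map-+ _ _ (allFin n))) ⟩
    Σ[ n ] (λ i → Σ[ n ] (below i) + Σ[ n ] (above i))
      ≡⟨ sum-map-+ _ _ (allFin n) ⟩
    E + Σ[ n ] (λ i → Σ[ n ] (above i))
      ≡⟨ cong (E +_) (trans (sum-map-cong (allFin n) above≡below-transposed) (sum-map-swap (λ i j → below j i) (allFin n) (allFin n))) ⟩
    E + E
      ≡⟨ cong (E +_) (sym (+-identityʳ E)) ⟩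
    2 * E
      ≡⟨ cong (2 *_) (sym numEdges-Σ) ⟩
    2 * numEdges A
      ∎
    where
    open ≡-Reasoning
    E : ℕ
    E = Σ[ n ] (λ i → Σ[ n ] (below i))
    above≡below-transposed : ∀ i → Σ[ n ] (above i) ≡ Σ[ n ] (λ j → below j i)
    above≡below-transposed i = sum-map-cong (allFin n) (λ j → cong (λ b → 𝟙 ((toℕ j <ᵇ toℕ i) ∧ b)) (proj₁ simple i j))

-- Pendant vertices

-- ι must be order preserving because edge lists only contain pairs (i , j) with i < j.
record PendantExtension {N M : ℕ} (G′ : Graph N) (G : Graph M) : Set where
  field
    ι             : Fin N → Fin M
    ι-mono        : ∀ {i j} → toℕ i < toℕ j → toℕ (ι i) < toℕ (ι j)
    leaf          : Fin M
    anchor        : Fin N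
    leaf≢ι        : ∀ i → leaf ≢ ι i
    leaf-or-ι     : ∀ z → z ≡ leaf ⊎ ∃ λ i → z ≡ ι i
    adj-ι-ι       : ∀ i j → G (ι i) (ι j) ≡ G′ i j
    adj-leaf-ι    : ∀ j → G leaf (ι j) ≡ (j == anchor)
    adj-ι-leaf    : ∀ j → G (ι j) leaf ≡ (j == anchor)
    adj-leaf-leaf : G leaf leaf ≡ false

module PendantExtensionProperties {N M : ℕ} {G′ : Graph N} {G : Graph M} (P : PendantExtension G′ G) where
  open PendantExtension P

  ι-injective : ∀ {i j} → ι i ≡ ι j → i ≡ j
  ι-injective {i} {j} e with <-cmp (toℕ i) (toℕ j)
  ... | tri< i<j _ _ = ⊥-elim (<-irrefl (cong toℕ e) (ι-mono i<j))
  ... | tri≈ _ i≡j _ = toℕ-injective i≡j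
  ... | tri> _ _ j<i = ⊥-elim (<-irrefl (cong toℕ (sym e)) (ι-mono j<i))

  ι-mono⁻ : ∀ {i j} → toℕ (ι i) < toℕ (ι j) → toℕ i < toℕ j
  ι-mono⁻ {i} {j} lt with <-cmp (toℕ i) (toℕ j)
  ... | tri< i<j _ _ = i<j
  ... | tri≈ _ i≡j _ rewrite toℕ-injective i≡j = ⊥-elim (<-irrefl refl lt)
  ... | tri> _ _ j<i = ⊥-elim (<-asym lt (ι-mono j<i))

  ι² : Edge N → Edge M
  ι² (a , b) = ι a , ι b

  ι²-injective : ∀ {e e′} → ι² e ≡ ι² e′ → e ≡ e′
  ι²-injective eq = cong₂ _,_ (ι-injective (cong proj₁ eq)) (ι-injective (cong proj₂ eq))

  leaf∉ι : leaf ∉ map ι (allFin N)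
  leaf∉ι w∈ with ∈-map⁻ ι w∈
  ... | i , _ , e = leaf≢ι i e

  allFin-↭ : allFin M ↭ leaf ∷ map ι (allFin N)
  allFin-↭ = unique-↭ (Unique.allFin⁺ M) (¬Any⇒All¬ _ leaf∉ι ∷ Unique.map⁺ ι-injective (Unique.allFin⁺ N))
    (λ {z} _ → Sum.[ (λ { refl → here refl }) , (λ { (i , refl) → there (∈-map⁺ ι (∈-allFin i)) }) ] (leaf-or-ι z))
    (λ {z} _ → ∈-allFin z)

  Σ-leaf : ∀ (h : Fin M → ℕ) → Σ[ M ] h ≡ h leaf + Σ[ N ] (h ∘ ι)
  Σ-leaf h = trans (sum-↭ (↭-map⁺ h allFin-↭)) (cong (h leaf +_) (sum-map-∘ h ι (allFin N)))

  newEdge : Edge M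
  newEdge = if toℕ (ι anchor) <ᵇ toℕ leaf then (ι anchor , leaf) else (leaf , ι anchor)

  newEdge-cases : (newEdge ≡ (ι anchor , leaf) × toℕ (ι anchor) < toℕ leaf)
                ⊎ (newEdge ≡ (leaf , ι anchor) × toℕ leaf < toℕ (ι anchor))
  newEdge-cases with toℕ (ι anchor) <ᵇ toℕ leaf in eq
  ... | true = inj₁ (refl , <ᵇ-true eq)
  ... | false with <-cmp (toℕ leaf) (toℕ (ι anchor))
  ... | tri< w<u _ _ = inj₂ (refl , w<u)
  ... | tri≈ _ w≡u _ = ⊥-elim (leaf≢ι anchor (toℕ-injective w≡u))
  ... | tri> _ _ u<w = ⊥-elim (subst T eq (<⇒<ᵇ u<w))

  newEdge∉ : newEdge ∉ map ι² (edges G′)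
  newEdge∉ e∈ with ∈-map⁻ ι² e∈ | newEdge-cases
  ... | (a , b) , _ , eq | inj₁ (eq′ , _) = leaf≢ι b (trans (sym (cong proj₂ eq′)) (cong proj₂ eq))
  ... | (a , b) , _ , eq | inj₂ (eq′ , _) = leaf≢ι a (trans (sym (cong proj₁ eq′)) (cong proj₁ eq))

  edges-↭ : edges G ↭ newEdge ∷ map ι² (edges G′)
  edges-↭ = unique-↭ (edges-unique G)
    (¬Any⇒All¬ _ newEdge∉ ∷ Unique.map⁺ ι²-injective (edges-unique G′)) to from
    where
    anchor==anchor : (anchor == anchor) ≡ true
    anchor==anchor = ==-refl anchor
    to : ∀ {z} → z ∈ edges G → z ∈ newEdge ∷ map ι² (edges G′)
    to {a , b} ab∈ with ∈-edges⁻ G ab∈ | leaf-or-ι a | leaf-or-ι b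
    ... | a<b , _ | inj₁ refl | inj₁ refl = ⊥-elim (<-irrefl refl a<b)
    ... | a<b , a~b | inj₁ refl | inj₂ (j , refl) with ==⇒≡ {i = j} (subst T (adj-leaf-ι j) a~b) | newEdge-cases
    ...   | refl | inj₁ (_ , b<a) = ⊥-elim (<-asym a<b b<a)
    ...   | refl | inj₂ (eq , _)  = here (sym eq)
    to {a , b} ab∈ | a<b , a~b | inj₂ (i , refl) | inj₁ refl with ==⇒≡ {i = i} (subst T (adj-ι-leaf i) a~b) | newEdge-cases
    ...   | refl | inj₁ (eq , _)  = here (sym eq)
    ...   | refl | inj₂ (_ , b<a) = ⊥-elim (<-asym a<b b<a)
    to {a , b} ab∈ | a<b , a~b | inj₂ (i , refl) | inj₂ (j , refl) =
      there (∈-map⁺ ι² (∈-edges⁺ G′ (ι-mono⁻ a<b) (subst T (adj-ι-ι i j) a~b)))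
    from : ∀ {z} → z ∈ newEdge ∷ map ι² (edges G′) → z ∈ edges G
    from (here refl) with newEdge-cases
    ... | inj₁ (eq , lt) rewrite eq = ∈-edges⁺ G lt (subst T (sym (trans (adj-ι-leaf anchor) anchor==anchor)) tt)
    ... | inj₂ (eq , lt) rewrite eq = ∈-edges⁺ G lt (subst T (sym (trans (adj-leaf-ι anchor) anchor==anchor)) tt)
    from (there z∈) with ∈-map⁻ ι² z∈
    ... | (i , j) , ij∈ , refl with ∈-edges⁻ G′ ij∈
    ...   | i<j , i~j = ∈-edges⁺ G (ι-mono i<j) (subst T (sym (adj-ι-ι i j)) i~j)

  numEdges-extension : numEdges G ≡ suc (numEdges G′)
  numEdges-extension = trans (↭-length edges-↭) (cong suc (length-map ι² (edges G′)))

Reachable-mono : ∀ {n} {S₁ S₂ : List (Edge n)} → (∀ {x y} → Adjacent S₁ x y → Adjacent S₂ x y) →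
                 ∀ {a b} → Reachable S₁ a b → Reachable S₂ a b
Reachable-mono {S₁ = S₁} {S₂} sub {a} = Reachable-elim S₁ (Reachable S₂ a) (Reachable-refl S₂ a) (λ r c~b → Reachable-step S₂ r (sub c~b))

picks-map : ∀ {X Y : Set} (g : X → Y) L → picks (map g L) ≡ map (λ p → g (proj₁ p) , map g (proj₂ p)) (picks L)
picks-map g []      = refl
picks-map g (x ∷ L) = cong ((g x , map g L) ∷_) (trans (cong (map _) (picks-map g L)) (trans (sym (map-∘ (picks L))) (map-∘ (picks L))))

-- A spanning subgraph S′ of G′ yields two spanning subgraphs of G: lift S′, where the leaf is
-- isolated, and hang S′, where the leaf hangs on the anchor.  Every spanning subgraph of G is
-- one of these.
module SpanningSubgraphs {N M : ℕ} {G′ : Graph N} {G : Graph M} (P : PendantExtension G′ G) where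
  open PendantExtension P
  open PendantExtensionProperties P

  lift hang : List (Edge N) → List (Edge M)
  lift S′ = map ι² S′
  hang S′ = newEdge ∷ lift S′

  module _ (S′ : List (Edge N)) where

    Adjacent-lift⁻ : ∀ {x y} → Adjacent (lift S′) x y → ∃ λ i → ∃ λ j → x ≡ ι i × y ≡ ι j × Adjacent S′ i j
    Adjacent-lift⁻ (inj₁ xy∈) with ∈-map⁻ ι² xy∈
    ... | (i , j) , ij∈ , refl = i , j , refl , refl , inj₁ ij∈
    Adjacent-lift⁻ (inj₂ yx∈) with ∈-map⁻ ι² yx∈
    ... | (i , j) , ij∈ , refl = j , i , refl , refl , inj₂ ij∈

    Adjacent-lift⁺ : ∀ {i j} → Adjacent S′ i j → Adjacent (lift S′) (ι i) (ι j)
    Adjacent-lift⁺ (inj₁ ij∈) = inj₁ (∈-map⁺ ι² ij∈)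
    Adjacent-lift⁺ (inj₂ ji∈) = inj₂ (∈-map⁺ ι² ji∈)

    NewEdge : Fin M → Fin M → Set
    NewEdge x y = (x ≡ ι anchor × y ≡ leaf) ⊎ (x ≡ leaf × y ≡ ι anchor)

    newEdge-ends : ∀ {x y} → (x , y) ≡ newEdge → NewEdge x y
    newEdge-ends eq with newEdge-cases
    ... | inj₁ (eq′ , _) = inj₁ (cong proj₁ (trans eq eq′) , cong proj₂ (trans eq eq′))
    ... | inj₂ (eq′ , _) = inj₂ (cong proj₁ (trans eq eq′) , cong proj₂ (trans eq eq′))

    NewEdge-sym : ∀ {x y} → NewEdge y x → NewEdge x y
    NewEdge-sym = Sum.swap ∘ Sum.map Product.swap Product.swap

    Adjacent-hang⁻ : ∀ {x y} → Adjacent (hang S′) x y → Adjacent (lift S′) x y ⊎ NewEdge x y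
    Adjacent-hang⁻ (inj₁ (here eq))  = inj₂ (newEdge-ends eq)
    Adjacent-hang⁻ (inj₁ (there xy∈)) = inj₁ (inj₁ xy∈)
    Adjacent-hang⁻ (inj₂ (here eq))  = inj₂ (NewEdge-sym (newEdge-ends eq))
    Adjacent-hang⁻ (inj₂ (there yx∈)) = inj₁ (inj₂ yx∈)

    Adjacent-lift⇒hang : ∀ {x y} → Adjacent (lift S′) x y → Adjacent (hang S′) x y
    Adjacent-lift⇒hang = Sum.map there there

    Adjacent-hang-leaf : Adjacent (hang S′) leaf (ι anchor)
    Adjacent-hang-leaf with newEdge-cases
    ... | inj₁ (eq , _) = inj₂ (here (sym eq))
    ... | inj₂ (eq , _) = inj₁ (here (sym eq))

    Reachable-lift⁺ : ∀ {a b} → Reachable S′ a b → Reachable (lift S′) (ι a) (ι b)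
    Reachable-lift⁺ {a} = Reachable-elim S′ (λ z → Reachable (lift S′) (ι a) (ι z)) (Reachable-refl _ (ι a))
      (λ r c~b → Reachable-step (lift S′) r (Adjacent-lift⁺ c~b))

    Reachable-lift⁻ : ∀ {a z} → Reachable (lift S′) (ι a) z → ∃ λ b → z ≡ ι b × Reachable S′ a b
    Reachable-lift⁻ {a} = Reachable-elim (lift S′) (λ z → ∃ λ b → z ≡ ι b × Reachable S′ a b) (a , refl , Reachable-refl S′ a) step
      where
      step : ∀ {c b} → (∃ λ b′ → c ≡ ι b′ × Reachable S′ a b′) → Adjacent (lift S′) c b → ∃ λ b″ → b ≡ ι b″ × Reachable S′ a b″
      step (b′ , refl , r) c~b with Adjacent-lift⁻ c~b
      ... | i , j , e , refl , i~j rewrite ι-injective e = j , refl , Reachable-step S′ r i~j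

    Reachable-lift-leaf : ∀ {z} → Reachable (lift S′) leaf z → z ≡ leaf
    Reachable-lift-leaf = Reachable-elim (lift S′) (_≡ leaf) refl step
      where
      step : ∀ {c b} → c ≡ leaf → Adjacent (lift S′) c b → b ≡ leaf
      step refl c~b with Adjacent-lift⁻ c~b
      ... | i , _ , e , _ = ⊥-elim (leaf≢ι i e)

    Reachable-hang⁻ : ∀ {a z} → Reachable (hang S′) (ι a) z →
                      (z ≡ leaf × Reachable S′ a anchor) ⊎ (∃ λ b → z ≡ ι b × Reachable S′ a b)
    Reachable-hang⁻ {a} = Reachable-elim (hang S′) Q (inj₂ (a , refl , Reachable-refl S′ a)) step
      where
      Q : Fin M → Set
      Q z = (z ≡ leaf × Reachable S′ a anchor) ⊎ (∃ λ b → z ≡ ι b × Reachable S′ a b)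
      step : ∀ {c b} → Q c → Adjacent (hang S′) c b → Q b
      step q c~b with Adjacent-hang⁻ c~b
      step (inj₁ (refl , _)) _ | inj₁ c~b′ with Adjacent-lift⁻ c~b′
      ... | i , _ , e , _ = ⊥-elim (leaf≢ι i e)
      step (inj₂ (b′ , refl , r)) _ | inj₁ c~b′ with Adjacent-lift⁻ c~b′
      ... | i , j , e , refl , i~j rewrite ι-injective e = inj₂ (j , refl , Reachable-step S′ r i~j)
      step (inj₁ (refl , _)) _ | inj₂ (inj₁ (e , _)) = ⊥-elim (leaf≢ι anchor e)
      step (inj₁ (refl , r)) _ | inj₂ (inj₂ (_ , refl)) = inj₂ (anchor , refl , r)
      step (inj₂ (b′ , refl , r)) _ | inj₂ (inj₁ (e , refl)) rewrite ι-injective e = inj₁ (refl , r)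
      step (inj₂ (b′ , refl , r)) _ | inj₂ (inj₂ (e , _)) = ⊥-elim (leaf≢ι b′ (sym e))

    Reachable-hang-ι⁻ : ∀ {a b} → Reachable (hang S′) (ι a) (ι b) → Reachable S′ a b
    Reachable-hang-ι⁻ r with Reachable-hang⁻ r
    ... | inj₁ (e , _) = ⊥-elim (leaf≢ι _ (sym e))
    ... | inj₂ (b′ , e , r′) rewrite ι-injective e = r′

    Reachable-hang-leaf⁻ : ∀ {b} → Reachable (hang S′) leaf (ι b) → Reachable S′ anchor b
    Reachable-hang-leaf⁻ r with Reachable-hang⁻ (Reachable-sym (hang S′) r)
    ... | inj₁ (_ , r′)     = Reachable-sym S′ r′
    ... | inj₂ (b′ , e , _) = ⊥-elim (leaf≢ι b′ e)

    Reachable-hang-leaf⁺ : ∀ {b} → Reachable S′ anchor b → Reachable (hang S′) leaf (ι b)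
    Reachable-hang-leaf⁺ r = Reachable-trans (hang S′) (Reachable-step (hang S′) (Reachable-refl _ leaf) Adjacent-hang-leaf)
      (Reachable-mono Adjacent-lift⇒hang (Reachable-lift⁺ r))

    conn-hang-ι : ∀ a b → conn (hang S′) (ι a) (ι b) ≡ conn S′ a b
    conn-hang-ι a b = T-ext (Reachable⇒conn S′ ∘ Reachable-hang-ι⁻ ∘ conn⇒Reachable (hang S′))
      (Reachable⇒conn (hang S′) ∘ Reachable-mono Adjacent-lift⇒hang ∘ Reachable-lift⁺ ∘ conn⇒Reachable S′)

    conn-lift-ι : ∀ a b → conn (lift S′) (ι a) (ι b) ≡ conn S′ a b
    conn-lift-ι a b = T-ext (back ∘ Reachable-lift⁻ ∘ conn⇒Reachable (lift S′)) (Reachable⇒conn (lift S′) ∘ Reachable-lift⁺ ∘ conn⇒Reachable S′)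
      where
      back : (∃ λ b′ → ι b ≡ ι b′ × Reachable S′ a b′) → T (conn S′ a b)
      back (b′ , e , r) rewrite ι-injective e = Reachable⇒conn S′ r

    conn-hang-leaf : ∀ b → conn (hang S′) leaf (ι b) ≡ conn S′ anchor b
    conn-hang-leaf b = T-ext (Reachable⇒conn S′ ∘ Reachable-hang-leaf⁻ ∘ conn⇒Reachable (hang S′))
      (Reachable⇒conn (hang S′) ∘ Reachable-hang-leaf⁺ ∘ conn⇒Reachable S′)

    conn-hang-leafʳ : ∀ b → conn (hang S′) (ι b) leaf ≡ conn S′ b anchor
    conn-hang-leafʳ b = trans (conn-sym (hang S′) (ι b) leaf) (trans (conn-hang-leaf b) (conn-sym S′ anchor b))

    conn-lift-leaf : ∀ b → conn (lift S′) leaf (ι b) ≡ false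
    conn-lift-leaf b = T-ext (λ h → leaf≢ι b (sym (Reachable-lift-leaf (conn⇒Reachable (lift S′) h)))) λ ()

    conn-lift-leafʳ : ∀ b → conn (lift S′) (ι b) leaf ≡ false
    conn-lift-leafʳ b = trans (conn-sym (lift S′) (ι b) leaf) (conn-lift-leaf b)

  module _ (S′ : List (Edge N)) where

    acyclic-lift : acyclic (lift S′) ≡ acyclic S′
    acyclic-lift = trans (cong (all _) (picks-map ι² S′)) (trans (all-map _ _ (picks S′))
      (all-cong (picks S′) (λ p → cong not (conn-lift-ι (proj₂ p) (proj₁ (proj₁ p)) (proj₂ (proj₁ p))))))

    conn-lift-newEdge : conn (lift S′) (proj₁ newEdge) (proj₂ newEdge) ≡ false
    conn-lift-newEdge with newEdge-cases
    ... | inj₁ (eq , _) rewrite eq = conn-lift-leafʳ S′ anchor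
    ... | inj₂ (eq , _) rewrite eq = conn-lift-leaf S′ anchor

    acyclic-hang : acyclic (hang S′) ≡ acyclic S′
    acyclic-hang = cong₂ _∧_ (cong not conn-lift-newEdge) (trans (all-map _ _ (picks (lift S′)))
      (trans (cong (all _) (picks-map ι² S′)) (trans (all-map _ _ (picks S′))
      (all-cong (picks S′) (λ p → cong not (conn-hang-ι (proj₂ p) (proj₁ (proj₁ p)) (proj₂ (proj₁ p))))))))

    connectedE-hang : connectedE (hang S′) ≡ connectedE S′
    connectedE-hang = T-ext (λ h → connectedE⁺ S′ (λ a b → subst T (conn-hang-ι S′ a b) (connectedE⁻ (hang S′) h (ι a) (ι b))))
                            (λ h → connectedE⁺ (hang S′) (λ z z′ → connected z z′ (leaf-or-ι z) (leaf-or-ι z′) (connectedE⁻ S′ h)))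
      where
      connected : ∀ z z′ → z ≡ leaf ⊎ ∃ (λ i → z ≡ ι i) → z′ ≡ leaf ⊎ ∃ (λ i → z′ ≡ ι i) →
                  (∀ a b → T (conn S′ a b)) → T (conn (hang S′) z z′)
      connected _ _ (inj₁ refl)       (inj₁ refl)       h = subst T (sym (conn-refl (hang S′) leaf)) tt
      connected _ _ (inj₁ refl)       (inj₂ (j , refl)) h = subst T (sym (conn-hang-leaf S′ j)) (h anchor j)
      connected _ _ (inj₂ (i , refl)) (inj₁ refl)       h = subst T (sym (conn-hang-leafʳ S′ i)) (h i anchor)
      connected _ _ (inj₂ (i , refl)) (inj₂ (j , refl)) h = subst T (sym (conn-hang-ι S′ i j)) (h i j)

    connectedE-lift : connectedE (lift S′) ≡ false
    connectedE-lift = T-ext (λ h → subst T (conn-lift-leaf S′ anchor) (connectedE⁻ (lift S′) h leaf (ι anchor))) λ ()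

    twoForest-hang-ι : ∀ a b → twoForest (hang S′) (ι a) (ι b) ≡ twoForest S′ a b
    twoForest-hang-ι a b = T-ext to from
      where
      to : T (twoForest (hang S′) (ι a) (ι b)) → T (twoForest S′ a b)
      to h with twoForest⁻ (hang S′) (ι a) (ι b) h
      ... | acyc , apart , covered = twoForest⁺ S′ a b (subst T acyclic-hang acyc ,
            apart ∘ subst T (sym (conn-hang-ι S′ a b)) ,
            λ z → Sum.map (subst T (conn-hang-ι S′ z a)) (subst T (conn-hang-ι S′ z b)) (covered (ι z)))
      from : T (twoForest S′ a b) → T (twoForest (hang S′) (ι a) (ι b))
      from h with twoForest⁻ S′ a b h
      ... | acyc , apart , covered = twoForest⁺ (hang S′) (ι a) (ι b) (subst T (sym acyclic-hang) acyc ,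
            apart ∘ subst T (conn-hang-ι S′ a b) , λ z → cover z (leaf-or-ι z))
        where
        cover : ∀ z → z ≡ leaf ⊎ ∃ (λ i → z ≡ ι i) → T (conn (hang S′) z (ι a)) ⊎ T (conn (hang S′) z (ι b))
        cover _ (inj₁ refl) = Sum.map (subst T (sym (conn-hang-leaf S′ a))) (subst T (sym (conn-hang-leaf S′ b))) (covered anchor)
        cover _ (inj₂ (c , refl)) = Sum.map (subst T (sym (conn-hang-ι S′ c a))) (subst T (sym (conn-hang-ι S′ c b))) (covered c)

    twoForest-lift-ι : ∀ a b → twoForest (lift S′) (ι a) (ι b) ≡ false
    twoForest-lift-ι a b = T-ext to λ ()
      where
      to : T (twoForest (lift S′) (ι a) (ι b)) → T false
      to h with proj₂ (proj₂ (twoForest⁻ (lift S′) (ι a) (ι b) h)) leaf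
      ... | inj₁ leaf-a = subst T (conn-lift-leaf S′ a) leaf-a
      ... | inj₂ leaf-b = subst T (conn-lift-leaf S′ b) leaf-b

    twoForest-hang-leaf : ∀ b → twoForest (hang S′) leaf (ι b) ≡ twoForest S′ anchor b
    twoForest-hang-leaf b = T-ext to from
      where
      to : T (twoForest (hang S′) leaf (ι b)) → T (twoForest S′ anchor b)
      to h with twoForest⁻ (hang S′) leaf (ι b) h
      ... | acyc , apart , covered = twoForest⁺ S′ anchor b (subst T acyclic-hang acyc ,
            apart ∘ subst T (sym (conn-hang-leaf S′ b)) ,
            λ z → Sum.map (subst T (conn-hang-leafʳ S′ z)) (subst T (conn-hang-ι S′ z b)) (covered (ι z)))
      from : T (twoForest S′ anchor b) → T (twoForest (hang S′) leaf (ι b))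
      from h with twoForest⁻ S′ anchor b h
      ... | acyc , apart , covered = twoForest⁺ (hang S′) leaf (ι b) (subst T (sym acyclic-hang) acyc ,
            apart ∘ subst T (conn-hang-leaf S′ b) , λ z → cover z (leaf-or-ι z))
        where
        cover : ∀ z → z ≡ leaf ⊎ ∃ (λ i → z ≡ ι i) → T (conn (hang S′) z leaf) ⊎ T (conn (hang S′) z (ι b))
        cover _ (inj₁ refl) = inj₁ (subst T (sym (conn-refl (hang S′) leaf)) tt)
        cover _ (inj₂ (c , refl)) = Sum.map (subst T (sym (conn-hang-leafʳ S′ c))) (subst T (sym (conn-hang-ι S′ c b))) (covered c)

    twoForest-lift-leaf : ∀ b → twoForest (lift S′) leaf (ι b) ≡ isTree S′
    twoForest-lift-leaf b = T-ext to from
      where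
      to : T (twoForest (lift S′) leaf (ι b)) → T (isTree S′)
      to h with twoForest⁻ (lift S′) leaf (ι b) h
      ... | acyc , _ , covered = T-∧⁺ (connectedE⁺ S′ (λ a c → Reachable⇒conn S′ (Reachable-trans S′ (toB a) (Reachable-sym S′ (toB c)))))
                                      (subst T acyclic-lift acyc)
        where
        toB : ∀ c → Reachable S′ c b
        toB c with covered (ι c)
        ... | inj₁ c-leaf = ⊥-elim (subst T (conn-lift-leafʳ S′ c) c-leaf)
        ... | inj₂ c-b    = conn⇒Reachable S′ (subst T (conn-lift-ι S′ c b) c-b)
      from : T (isTree S′) → T (twoForest (lift S′) leaf (ι b))
      from h with T-∧⁻ {connectedE S′} h
      ... | connected , acyc = twoForest⁺ (lift S′) leaf (ι b) (subst T (sym acyclic-lift) acyc ,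
            subst T (conn-lift-leaf S′ b) , λ z → cover z (leaf-or-ι z))
        where
        cover : ∀ z → z ≡ leaf ⊎ ∃ (λ i → z ≡ ι i) → T (conn (lift S′) z leaf) ⊎ T (conn (lift S′) z (ι b))
        cover _ (inj₁ refl)       = inj₁ (subst T (sym (conn-refl (lift S′) leaf)) tt)
        cover _ (inj₂ (c , refl)) = inj₂ (subst T (sym (conn-lift-ι S′ c b)) (connectedE⁻ S′ connected c b))

module PendantCounts {N M : ℕ} {G′ : Graph N} {G : Graph M} (P : PendantExtension G′ G) where
  open PendantExtension P
  open PendantExtensionProperties P
  open SpanningSubgraphs P

  isSimple-extension : IsSimple G′ → IsSimple G
  isSimple-extension (symmetric , loopless) = (λ z z′ → sym′ (leaf-or-ι z) (leaf-or-ι z′)) , loopless′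
    where
    sym′ : ∀ {z z′} → z ≡ leaf ⊎ ∃ (λ i → z ≡ ι i) → z′ ≡ leaf ⊎ ∃ (λ i → z′ ≡ ι i) → G z z′ ≡ G z′ z
    sym′ (inj₁ refl)       (inj₁ refl)       = refl
    sym′ (inj₁ refl)       (inj₂ (j , refl)) = trans (adj-leaf-ι j) (sym (adj-ι-leaf j))
    sym′ (inj₂ (i , refl)) (inj₁ refl)       = trans (adj-ι-leaf i) (sym (adj-leaf-ι i))
    sym′ (inj₂ (i , refl)) (inj₂ (j , refl)) = trans (adj-ι-ι i j) (trans (symmetric i j) (sym (adj-ι-ι j i)))
    loopless′ : ∀ z → G z z ≡ false
    loopless′ z with leaf-or-ι z
    ... | inj₁ refl       = adj-leaf-leaf
    ... | inj₂ (i , refl) = trans (adj-ι-ι i i) (loopless i)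

  countSubsets-extension : ∀ (Q : List (Edge M) → Bool) → Invariant↭ Q → ∀ {Qʰ Qˡ : List (Edge N) → Bool} →
    (∀ S′ → Q (hang S′) ≡ Qʰ S′) → (∀ S′ → Q (lift S′) ≡ Qˡ S′) →
    countSubsets Q (edges G) ≡ countSubsets Qʰ (edges G′) + countSubsets Qˡ (edges G′)
  countSubsets-extension Q inv onHang onLift = begin
    countSubsets Q (edges G)
      ≡⟨ countSubsets-↭ edges-↭ Q inv ⟩
    countSubsets Q (newEdge ∷ lift (edges G′))
      ≡⟨ countSubsets-∷ Q newEdge (lift (edges G′)) ⟩
    countSubsets (Q ∘ (newEdge ∷_)) (lift (edges G′)) + countSubsets Q (lift (edges G′))
      ≡⟨ cong₂ _+_ (countSubsets-map (Q ∘ (newEdge ∷_)) ι² (edges G′)) (countSubsets-map Q ι² (edges G′)) ⟩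
    countSubsets (Q ∘ hang) (edges G′) + countSubsets (Q ∘ lift) (edges G′)
      ≡⟨ cong₂ _+_ (countSubsets-cong (edges G′) onHang) (countSubsets-cong (edges G′) onLift) ⟩
    countSubsets _ (edges G′) + countSubsets _ (edges G′)
      ∎
    where open ≡-Reasoning

  τ-extension : τ G ≡ τ G′
  τ-extension = begin
    τ G                                                        ≡⟨ τ-countSubsets G ⟩
    countSubsets isTree (edges G)                              ≡⟨ countSubsets-extension isTree isTree-↭ onHang onLift ⟩
    countSubsets isTree (edges G′) + countSubsets _ (edges G′) ≡⟨ cong (countSubsets isTree (edges G′) +_) (countSubsets-false (edges G′)) ⟩
    countSubsets isTree (edges G′) + 0                         ≡⟨ +-identityʳ _ ⟩
    countSubsets isTree (edges G′)                             ≡⟨ τ-countSubsets G′ ⟨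
    τ G′                                                       ∎
    where
    open ≡-Reasoning
    onHang : ∀ S′ → isTree (hang S′) ≡ isTree S′
    onHang S′ = cong₂ _∧_ (connectedE-hang S′) (acyclic-hang S′)
    onLift : ∀ S′ → isTree (lift S′) ≡ false
    onLift S′ = cong (_∧ acyclic (lift S′)) (connectedE-lift S′)

  f-extension-ι-ι : ∀ a b → f G (ι a) (ι b) ≡ f G′ a b
  f-extension-ι-ι a b = begin
    f G (ι a) (ι b)
      ≡⟨ f-countSubsets G (ι a) (ι b) ⟩
    countSubsets (λ S → twoForest S (ι a) (ι b)) (edges G)
      ≡⟨ countSubsets-extension _ (twoForest-↭ (ι a) (ι b)) (λ S′ → twoForest-hang-ι S′ a b) (λ S′ → twoForest-lift-ι S′ a b) ⟩
    countSubsets (λ S′ → twoForest S′ a b) (edges G′) + countSubsets _ (edges G′)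
      ≡⟨ cong (countSubsets (λ S′ → twoForest S′ a b) (edges G′) +_) (countSubsets-false (edges G′)) ⟩
    countSubsets (λ S′ → twoForest S′ a b) (edges G′) + 0
      ≡⟨ trans (+-identityʳ _) (sym (f-countSubsets G′ a b)) ⟩
    f G′ a b
      ∎
    where open ≡-Reasoning

  f-extension-leaf-ι : ∀ b → f G leaf (ι b) ≡ τ G′ + f G′ anchor b
  f-extension-leaf-ι b = begin
    f G leaf (ι b)
      ≡⟨ f-countSubsets G leaf (ι b) ⟩
    countSubsets (λ S → twoForest S leaf (ι b)) (edges G)
      ≡⟨ countSubsets-extension _ (twoForest-↭ leaf (ι b)) (λ S′ → twoForest-hang-leaf S′ b) (λ S′ → twoForest-lift-leaf S′ b) ⟩
    countSubsets (λ S′ → twoForest S′ anchor b) (edges G′) + countSubsets isTree (edges G′)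
      ≡⟨ cong₂ _+_ (sym (f-countSubsets G′ anchor b)) (sym (τ-countSubsets G′)) ⟩
    f G′ anchor b + τ G′
      ≡⟨ +-comm (f G′ anchor b) (τ G′) ⟩
    τ G′ + f G′ anchor b
      ∎
    where open ≡-Reasoning

  f-extension-ι-leaf : ∀ a → f G (ι a) leaf ≡ τ G′ + f G′ anchor a
  f-extension-ι-leaf a = trans (f-sym G (ι a) leaf) (f-extension-leaf-ι a)

  deg-extension-ι : ∀ i → deg G (ι i) ≡ 𝟙 (i == anchor) + deg G′ i
  deg-extension-ι i = trans (deg-Σ G (ι i)) (trans (Σ-leaf (𝟙 ∘ G (ι i)))
    (cong₂ _+_ (cong 𝟙 (adj-ι-leaf i)) (trans (sum-map-cong (allFin N) (cong 𝟙 ∘ adj-ι-ι i)) (sym (deg-Σ G′ i)))))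

  deg-leaf : deg G leaf ≡ 1
  deg-leaf = trans (deg-Σ G leaf) (trans (Σ-leaf (𝟙 ∘ G leaf))
    (cong₂ _+_ (cong 𝟙 adj-leaf-leaf)
               (trans (sum-map-cong (allFin N) (λ j → trans (cong 𝟙 (adj-leaf-ι j)) (sym (*-identityʳ _)))) (Σ-𝟙== N anchor (λ _ → 1)))))

  Σ-anchor : ∀ (D X : Fin N → ℕ) → Σ[ N ] (λ i → (𝟙 (i == anchor) + D i) * X i) ≡ X anchor + Σ[ N ] (λ i → D i * X i)
  Σ-anchor D X = trans (sum-map-cong (allFin N) (λ i → *-distribʳ-+ (X i) (𝟙 (i == anchor)) (D i)))
    (trans (sum-map-+ (λ i → 𝟙 (i == anchor) * X i) (λ i → D i * X i) (allFin N))
           (cong (_+ Σ[ N ] (λ i → D i * X i)) (Σ-𝟙== N anchor X)))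

  private
    τ′ m′ : ℕ
    τ′ = τ G′
    m′ = numEdges G′
    d′ : Fin N → ℕ
    d′ = deg G′

  Σ-deg-f-anchor : Σ[ N ] (λ i → d′ i * f G′ anchor i) ≡ dfv G′ anchor
  Σ-deg-f-anchor = sum-map-cong (allFin N) (λ i → cong (d′ i *_) (f-sym G′ anchor i))

  dfv-extension-leaf : IsSimple G′ → dfv G leaf ≡ τ′ * suc (2 * m′) + dfv G′ anchor
  dfv-extension-leaf simple = begin
    dfv G leaf
      ≡⟨ Σ-leaf (λ z → deg G z * f G z leaf) ⟩
    deg G leaf * f G leaf leaf + Σ[ N ] (λ i → deg G (ι i) * f G (ι i) leaf)
      ≡⟨ cong₂ _+_ (cong₂ _*_ deg-leaf (f-diag G leaf)) (sum-map-cong (allFin N) (λ i → cong₂ _*_ (deg-extension-ι i) (f-extension-ι-leaf i))) ⟩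
    0 + Σ[ N ] (λ i → (𝟙 (i == anchor) + d′ i) * (τ′ + f G′ anchor i))
      ≡⟨ Σ-anchor d′ (λ i → τ′ + f G′ anchor i) ⟩
    (τ′ + f G′ anchor anchor) + Σ[ N ] (λ i → d′ i * (τ′ + f G′ anchor i))
      ≡⟨ cong₂ _+_ (cong (τ′ +_) (f-diag G′ anchor)) (sum-map-cong (allFin N) (λ i → *-distribˡ-+ (d′ i) τ′ (f G′ anchor i))) ⟩
    (τ′ + 0) + Σ[ N ] (λ i → d′ i * τ′ + d′ i * f G′ anchor i)
      ≡⟨ cong ((τ′ + 0) +_) (sum-map-+ (λ i → d′ i * τ′) (λ i → d′ i * f G′ anchor i) (allFin N)) ⟩
    (τ′ + 0) + (Σ[ N ] (λ i → d′ i * τ′) + Σ[ N ] (λ i → d′ i * f G′ anchor i))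
      ≡⟨ cong (λ z → (τ′ + 0) + (z + Σ[ N ] (λ i → d′ i * f G′ anchor i)))
              (trans (sum-map-cong (allFin N) (λ i → *-comm (d′ i) τ′)) (trans (sum-map-*ˡ τ′ d′ (allFin N)) (cong (τ′ *_) (handshake G′ simple)))) ⟩
    (τ′ + 0) + (τ′ * (2 * m′) + Σ[ N ] (λ i → d′ i * f G′ anchor i))
      ≡⟨ cong (λ z → (τ′ + 0) + (τ′ * (2 * m′) + z)) Σ-deg-f-anchor ⟩
    (τ′ + 0) + (τ′ * (2 * m′) + dfv G′ anchor)
      ≡⟨ collect τ′ m′ (dfv G′ anchor) ⟩
    τ′ * suc (2 * m′) + dfv G′ anchor
      ∎
    where
    open ≡-Reasoning
    collect : ∀ t m g → (t + 0) + (t * (2 * m) + g) ≡ t * suc (2 * m) + g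
    collect = solve-∀

  dfv-extension-ι : ∀ a → dfv G (ι a) ≡ dfv G′ a + 2 * f G′ anchor a + τ′
  dfv-extension-ι a = begin
    dfv G (ι a)
      ≡⟨ Σ-leaf (λ z → deg G z * f G z (ι a)) ⟩
    deg G leaf * f G leaf (ι a) + Σ[ N ] (λ i → deg G (ι i) * f G (ι i) (ι a))
      ≡⟨ cong₂ _+_ (cong₂ _*_ deg-leaf (f-extension-leaf-ι a)) (sum-map-cong (allFin N) (λ i → cong₂ _*_ (deg-extension-ι i) (f-extension-ι-ι i a))) ⟩
    1 * (τ′ + f G′ anchor a) + Σ[ N ] (λ i → (𝟙 (i == anchor) + d′ i) * f G′ i a)
      ≡⟨ cong (1 * (τ′ + f G′ anchor a) +_) (Σ-anchor d′ (λ i → f G′ i a)) ⟩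
    1 * (τ′ + f G′ anchor a) + (f G′ anchor a + dfv G′ a)
      ≡⟨ collect τ′ (f G′ anchor a) (dfv G′ a) ⟩
    dfv G′ a + 2 * f G′ anchor a + τ′
      ∎
    where
    open ≡-Reasoning
    collect : ∀ t x g → 1 * (t + x) + (x + g) ≡ g + 2 * x + t
    collect = solve-∀

  dFd-extension : IsSimple G′ → dFd G ≡ dFd G′ + 4 * dfv G′ anchor + τ′ * (4 * m′ + 2)
  dFd-extension simple = begin
    dFd G
      ≡⟨ dFd-dfv G ⟩
    Σ[ M ] (λ z → deg G z * dfv G z)
      ≡⟨ Σ-leaf (λ z → deg G z * dfv G z) ⟩
    deg G leaf * dfv G leaf + Σ[ N ] (λ i → deg G (ι i) * dfv G (ι i))
      ≡⟨ cong₂ _+_ (cong₂ _*_ deg-leaf (dfv-extension-leaf simple)) (sum-map-cong (allFin N) (λ i → cong₂ _*_ (deg-extension-ι i) (dfv-extension-ι i))) ⟩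
    1 * (τ′ * suc (2 * m′) + g) + Σ[ N ] (λ i → (𝟙 (i == anchor) + d′ i) * (dfv G′ i + 2 * f G′ anchor i + τ′))
      ≡⟨ cong (1 * (τ′ * suc (2 * m′) + g) +_) (Σ-anchor d′ (λ i → dfv G′ i + 2 * f G′ anchor i + τ′)) ⟩
    1 * (τ′ * suc (2 * m′) + g) + ((g + 2 * f G′ anchor anchor + τ′) + Σ[ N ] (λ i → d′ i * (dfv G′ i + 2 * f G′ anchor i + τ′)))
      ≡⟨ cong₂ (λ x y → 1 * (τ′ * suc (2 * m′) + g) + ((g + 2 * x + τ′) + y)) (f-diag G′ anchor) rest ⟩
    1 * (τ′ * suc (2 * m′) + g) + ((g + 2 * 0 + τ′) + (dFd G′ + 2 * g + τ′ * (2 * m′)))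
      ≡⟨ collect τ′ m′ g (dFd G′) ⟩
    dFd G′ + 4 * g + τ′ * (4 * m′ + 2)
      ∎
    where
    open ≡-Reasoning
    g : ℕ
    g = dfv G′ anchor
    collect : ∀ t m g D → 1 * (t * suc (2 * m) + g) + ((g + 2 * 0 + t) + (D + 2 * g + t * (2 * m))) ≡ D + 4 * g + t * (4 * m + 2)
    collect = solve-∀
    expand : ∀ d g x t → d * (g + 2 * x + t) ≡ d * g + 2 * (d * x) + t * d
    expand = solve-∀
    rest : Σ[ N ] (λ i → d′ i * (dfv G′ i + 2 * f G′ anchor i + τ′)) ≡ dFd G′ + 2 * g + τ′ * (2 * m′)
    rest = begin
      Σ[ N ] (λ i → d′ i * (dfv G′ i + 2 * f G′ anchor i + τ′))
        ≡⟨ sum-map-cong (allFin N) (λ i → expand (d′ i) (dfv G′ i) (f G′ anchor i) τ′) ⟩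
      Σ[ N ] (λ i → d′ i * dfv G′ i + 2 * (d′ i * f G′ anchor i) + τ′ * d′ i)
        ≡⟨ sum-map-+ (λ i → d′ i * dfv G′ i + 2 * (d′ i * f G′ anchor i)) (λ i → τ′ * d′ i) (allFin N) ⟩
      Σ[ N ] (λ i → d′ i * dfv G′ i + 2 * (d′ i * f G′ anchor i)) + Σ[ N ] (λ i → τ′ * d′ i)
        ≡⟨ cong₂ _+_ (sum-map-+ (λ i → d′ i * dfv G′ i) (λ i → 2 * (d′ i * f G′ anchor i)) (allFin N)) (sum-map-*ˡ τ′ d′ (allFin N)) ⟩
      Σ[ N ] (λ i → d′ i * dfv G′ i) + Σ[ N ] (λ i → 2 * (d′ i * f G′ anchor i)) + τ′ * Σ[ N ] d′
        ≡⟨ cong₂ (λ x y → x + y + τ′ * Σ[ N ] d′) (sym (dFd-dfv G′)) (trans (sum-map-*ˡ 2 (λ i → d′ i * f G′ anchor i) (allFin N)) (cong (2 *_) Σ-deg-f-anchor)) ⟩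
      dFd G′ + 2 * g + τ′ * Σ[ N ] d′
        ≡⟨ cong (λ s → dFd G′ + 2 * g + τ′ * s) (handshake G′ simple) ⟩
      dFd G′ + 2 * g + τ′ * (2 * m′)
        ∎

-- Attaching a path

module PathAttachment {n : ℕ} (H : Graph n) (v : Fin n) where

  private
    t m g D : ℕ
    t = τ H
    m = numEdges H
    g = dfv H v
    D = dFd H

  -- Invariants of H with a path x … v … y attached at v, having k₁ edges from x to v and k₂ from v to y.
  record Attached {M : ℕ} (G : Graph M) (x y : Fin M) (k₁ k₂ : ℕ) : Set where
    field
      simple      : IsSimple G
      τ-eq        : τ G ≡ t
      numEdges-eq : numEdges G ≡ m + (k₁ + k₂)
      f-ends      : f G x y ≡ t * (k₁ + k₂)
      dfv-left    : dfv G x ≡ g + t * ((k₁ + k₂) * (k₁ + k₂) + 2 * m * k₁)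
      dfv-right   : dfv G y ≡ g + t * ((k₁ + k₂) * (k₁ + k₂) + 2 * m * k₂)
      dFd-eq      : 3 * dFd G ≡ 3 * D + 12 * (k₁ + k₂) * g
                      + t * (4 * ((k₁ + k₂) * (k₁ + k₂) * (k₁ + k₂)) + 2 * (k₁ + k₂) + 12 * m * (k₁ * k₁ + k₂ * k₂))

  attached-trivial : IsSimple H → Attached H v v 0 0
  attached-trivial simple = record
    { simple      = simple
    ; τ-eq        = refl
    ; numEdges-eq = sym (+-identityʳ m)
    ; f-ends      = trans (f-diag H v) (sym (*-zeroʳ t))
    ; dfv-left    = dfv-zero g t m
    ; dfv-right   = dfv-zero g t m
    ; dFd-eq      = dFd-zero D g t m
    }
    where
    dfv-zero : ∀ g t m → g ≡ g + t * (0 * 0 + 2 * m * 0)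
    dfv-zero = solve-∀
    dFd-zero : ∀ D g t m → 3 * D ≡ 3 * D + 12 * 0 * g + t * (4 * (0 * 0 * 0) + 2 * 0 + 12 * m * (0 * 0 + 0 * 0))
    dFd-zero = solve-∀

  attached-swap : ∀ {M} {G : Graph M} {x y k₁ k₂} → Attached G x y k₁ k₂ → Attached G y x k₂ k₁
  attached-swap {G = G} {x} {y} {k₁} {k₂} A = record
    { simple      = simple
    ; τ-eq        = τ-eq
    ; numEdges-eq = trans numEdges-eq (cong (m +_) (+-comm k₁ k₂))
    ; f-ends      = trans (f-sym G y x) (trans f-ends (cong (t *_) (+-comm k₁ k₂)))
    ; dfv-left    = trans dfv-right (cong (λ k → g + t * (k * k + 2 * m * k₂)) (+-comm k₁ k₂))
    ; dfv-right   = trans dfv-left (cong (λ k → g + t * (k * k + 2 * m * k₁)) (+-comm k₁ k₂))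
    ; dFd-eq      = trans dFd-eq (swap-ends D g t m k₁ k₂)
    }
    where
    open Attached A
    swap-ends : ∀ D g t m a b →
      3 * D + 12 * (a + b) * g + t * (4 * ((a + b) * (a + b) * (a + b)) + 2 * (a + b) + 12 * m * (a * a + b * b))
      ≡ 3 * D + 12 * (b + a) * g + t * (4 * ((b + a) * (b + a) * (b + a)) + 2 * (b + a) + 12 * m * (b * b + a * a))
    swap-ends = solve-∀

  module _ {N M : ℕ} {G′ : Graph N} {G : Graph M} (P : PendantExtension G′ G) where
    open PendantExtension P
    open PendantExtensionProperties P
    open PendantCounts P

    extend-right : ∀ {x k₁ k₂} → Attached G′ x anchor k₁ k₂ → Attached G (ι x) leaf k₁ (suc k₂)
    extend-right {x} {k₁} {k₂} A = record
      { simple      = isSimple-extension simple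
      ; τ-eq        = trans τ-extension τ-eq
      ; numEdges-eq = trans numEdges-extension (trans (cong suc numEdges-eq) (+-suc-right m k₁ k₂))
      ; f-ends      = begin
          f G (ι x) leaf                ≡⟨ f-extension-ι-leaf x ⟩
          τ G′ + f G′ anchor x          ≡⟨ cong₂ _+_ τ-eq (trans (f-sym G′ anchor x) f-ends) ⟩
          t + t * (k₁ + k₂)             ≡⟨ f-step t k₁ k₂ ⟩
          t * (k₁ + suc k₂)             ∎
      ; dfv-left    = begin
          dfv G (ι x)                                   ≡⟨ dfv-extension-ι x ⟩
          dfv G′ x + 2 * f G′ anchor x + τ G′           ≡⟨ cong₃ (λ a b c → a + 2 * b + c) dfv-left (trans (f-sym G′ anchor x) f-ends) τ-eq ⟩
          g + t * (k * k + 2 * m * k₁) + 2 * (t * k) + t ≡⟨ dfv-left-step g t m k₁ k₂ ⟩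
          g + t * ((k₁ + suc k₂) * (k₁ + suc k₂) + 2 * m * k₁) ∎
      ; dfv-right   = begin
          dfv G leaf                                    ≡⟨ dfv-extension-leaf simple ⟩
          τ G′ * suc (2 * numEdges G′) + dfv G′ anchor  ≡⟨ cong₃ (λ a b c → a * suc (2 * b) + c) τ-eq numEdges-eq dfv-right ⟩
          t * suc (2 * (m + k)) + (g + t * (k * k + 2 * m * k₂)) ≡⟨ dfv-right-step g t m k₁ k₂ ⟩
          g + t * ((k₁ + suc k₂) * (k₁ + suc k₂) + 2 * m * suc k₂) ∎
      ; dFd-eq      = begin
          3 * dFd G
            ≡⟨ cong (3 *_) (dFd-extension simple) ⟩
          3 * (dFd G′ + 4 * dfv G′ anchor + τ G′ * (4 * numEdges G′ + 2))
            ≡⟨ *-distribˡ-+ 3 (dFd G′ + 4 * dfv G′ anchor) _ ⟩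
          3 * (dFd G′ + 4 * dfv G′ anchor) + 3 * (τ G′ * (4 * numEdges G′ + 2))
            ≡⟨ cong (_+ 3 * (τ G′ * (4 * numEdges G′ + 2))) (*-distribˡ-+ 3 (dFd G′) (4 * dfv G′ anchor)) ⟩
          3 * dFd G′ + 3 * (4 * dfv G′ anchor) + 3 * (τ G′ * (4 * numEdges G′ + 2))
            ≡⟨ cong₃ (λ a b c → a + 3 * (4 * b) + 3 * c) dFd-eq dfv-right (cong₂ (λ a b → a * (4 * b + 2)) τ-eq numEdges-eq) ⟩
          3 * D + 12 * k * g + t * (4 * (k * k * k) + 2 * k + 12 * m * (k₁ * k₁ + k₂ * k₂))
            + 3 * (4 * (g + t * (k * k + 2 * m * k₂))) + 3 * (t * (4 * (m + k) + 2))
            ≡⟨ dFd-step D g t m k₁ k₂ ⟩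
          3 * D + 12 * (k₁ + suc k₂) * g
            + t * (4 * ((k₁ + suc k₂) * (k₁ + suc k₂) * (k₁ + suc k₂)) + 2 * (k₁ + suc k₂) + 12 * m * (k₁ * k₁ + suc k₂ * suc k₂))
            ∎
      }
      where
      open Attached A
      open ≡-Reasoning
      k : ℕ
      k = k₁ + k₂
      cong₃ : ∀ {a b c d e f} (h : ℕ → ℕ → ℕ → ℕ) → a ≡ b → c ≡ d → e ≡ f → h a c e ≡ h b d f
      cong₃ h refl refl refl = refl
      +-suc-right : ∀ m a b → suc (m + (a + b)) ≡ m + (a + suc b)
      +-suc-right = solve-∀
      f-step : ∀ t a b → t + t * (a + b) ≡ t * (a + suc b)
      f-step = solve-∀
      dfv-left-step : ∀ g t m a b →
        g + t * ((a + b) * (a + b) + 2 * m * a) + 2 * (t * (a + b)) + t ≡ g + t * ((a + suc b) * (a + suc b) + 2 * m * a)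
      dfv-left-step = solve-∀
      dfv-right-step : ∀ g t m a b →
        t * suc (2 * (m + (a + b))) + (g + t * ((a + b) * (a + b) + 2 * m * b)) ≡ g + t * ((a + suc b) * (a + suc b) + 2 * m * suc b)
      dfv-right-step = solve-∀
      dFd-step : ∀ D g t m a b →
        3 * D + 12 * (a + b) * g + t * (4 * ((a + b) * (a + b) * (a + b)) + 2 * (a + b) + 12 * m * (a * a + b * b))
          + 3 * (4 * (g + t * ((a + b) * (a + b) + 2 * m * b))) + 3 * (t * (4 * (m + (a + b)) + 2))
        ≡ 3 * D + 12 * (a + suc b) * g
          + t * (4 * ((a + suc b) * (a + suc b) * (a + suc b)) + 2 * (a + suc b) + 12 * m * (a * a + suc b * suc b))
      dFd-step = solve-∀

    extend-left : ∀ {y k₁ k₂} → Attached G′ anchor y k₁ k₂ → Attached G leaf (ι y) (suc k₁) k₂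
    extend-left = attached-swap ∘ extend-right ∘ attached-swap

-- The coalescence

splitAt-view : ∀ n {m} (z : Fin (n + m)) → (∃ λ x → z ≡ x ↑ˡ m) ⊎ (∃ λ e → z ≡ n ↑ʳ e)
splitAt-view n {m} z with splitAt n {m} z in eq
... | inj₁ x = inj₁ (x , sym (splitAt⁻¹-↑ˡ eq))
... | inj₂ e = inj₂ (e , sym (splitAt⁻¹-↑ʳ eq))

toℕ-↑ˡ-< : ∀ {n} m (x : Fin n) → toℕ (x ↑ˡ m) < n
toℕ-↑ˡ-< {n} m x = subst (_< n) (sym (toℕ-↑ˡ x m)) (toℕ<n x)

n≤toℕ-↑ʳ : ∀ n {m} (e : Fin m) → n ≤ toℕ (n ↑ʳ e)
n≤toℕ-↑ʳ n e = subst (n ≤_) (sym (toℕ-↑ʳ n e)) (m≤m+n n (toℕ e))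

fromℕ-or-inject₁ : ∀ K (e : Fin (suc K)) → e ≡ fromℕ K ⊎ ∃ λ e′ → e ≡ inject₁ e′
fromℕ-or-inject₁ zero    zero    = inj₁ refl
fromℕ-or-inject₁ (suc K) zero    = inj₂ (zero , refl)
fromℕ-or-inject₁ (suc K) (suc e) with fromℕ-or-inject₁ K e
... | inj₁ refl        = inj₁ refl
... | inj₂ (e′ , refl) = inj₂ (suc e′ , refl)

zero-or-suc : ∀ {K} (e : Fin (suc K)) → e ≡ zero ⊎ ∃ λ e′ → e ≡ suc e′
zero-or-suc zero    = inj₁ refl
zero-or-suc (suc e) = inj₂ (e , refl)

pathAdj-just⁻ : ∀ a b → T (pathAdj (just a) (just b)) → suc a ≡ b ⊎ suc b ≡ a
pathAdj-just⁻ a b h = Sum.map (≡ᵇ⇒≡ (suc a) b) (≡ᵇ⇒≡ (suc b) a) (T-∨⁻ {suc a ≡ᵇ b} h)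

pathAdj-just⁺ : ∀ a b → suc a ≡ b ⊎ suc b ≡ a → T (pathAdj (just a) (just b))
pathAdj-just⁺ a _ (inj₁ refl) = T-∨ˡ (≡⇒≡ᵇ (suc a) (suc a) refl)
pathAdj-just⁺ _ b (inj₂ refl) = T-∨ʳ {suc (suc b) ≡ᵇ b} (≡⇒≡ᵇ (suc b) (suc b) refl)

pathAdj-irrefl : ∀ a → pathAdj (just a) (just a) ≡ false
pathAdj-irrefl a = T-ext (λ h → Sum.[ suc≢ , suc≢ ] (pathAdj-just⁻ a a h)) λ ()
  where
  suc≢ : suc a ≡ a → T false
  suc≢ e = ⊥-elim (<-irrefl (sym e) (n<1+n a))

pathAdj-map-suc : ∀ a b → pathAdj (Maybe.map suc a) (Maybe.map suc b) ≡ pathAdj a b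
pathAdj-map-suc (just a) (just b) = refl
pathAdj-map-suc (just a) nothing  = refl
pathAdj-map-suc nothing  _        = refl

isJust0 : Maybe ℕ → Bool
isJust0 (just zero) = true
isJust0 _           = false

isJust0⁻ : ∀ a → T (isJust0 a) → a ≡ just 0
isJust0⁻ (just zero) _ = refl

pathAdj-0-suc : ∀ a → pathAdj (just 0) (Maybe.map suc a) ≡ isJust0 a
pathAdj-0-suc (just zero)    = refl
pathAdj-0-suc (just (suc _)) = refl
pathAdj-0-suc nothing        = refl

pathAdj-suc-0 : ∀ a → pathAdj (Maybe.map suc a) (just 0) ≡ isJust0 a
pathAdj-suc-0 (just zero)    = refl
pathAdj-suc-0 (just (suc _)) = refl
pathAdj-suc-0 nothing        = refl

pathAdj-top⁻ : ∀ K (a : Maybe ℕ) → (∀ q → a ≡ just q → q ≤ K) → T (pathAdj (just (suc K)) a) → a ≡ just K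
pathAdj-top⁻ K (just q) bound h with pathAdj-just⁻ (suc K) q h
... | inj₁ e = ⊥-elim (<-irrefl refl (≤-trans (≤-reflexive e) (≤-trans (bound q refl) (n≤1+n K))))
... | inj₂ e = cong just (suc-injective e)

pathAdj-topʳ⁻ : ∀ K (a : Maybe ℕ) → (∀ q → a ≡ just q → q ≤ K) → T (pathAdj a (just (suc K))) → a ≡ just K
pathAdj-topʳ⁻ K (just q) bound h with pathAdj-just⁻ q (suc K) h
... | inj₁ e = cong just (suc-injective e)
... | inj₂ e = ⊥-elim (<-irrefl refl (≤-trans (≤-reflexive e) (≤-trans (bound q refl) (n≤1+n K))))

module _ {n : ℕ} (H : Graph n) (m : ℕ) where

  hAdj-↑ˡ : ∀ x y → hAdj {n} {m} H (x ↑ˡ m) (y ↑ˡ m) ≡ H x y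
  hAdj-↑ˡ x y rewrite splitAt-↑ˡ n x m | splitAt-↑ˡ n y m = refl

  hAdj-↑ʳ-left : ∀ e z → hAdj {n} {m} H (n ↑ʳ e) z ≡ false
  hAdj-↑ʳ-left e z rewrite splitAt-↑ʳ n m e = refl

  hAdj-↑ʳ-right : ∀ z e → hAdj {n} {m} H z (n ↑ʳ e) ≡ false
  hAdj-↑ʳ-right z e rewrite splitAt-↑ʳ n m e with splitAt n {m} z
  ... | inj₁ _ = refl
  ... | inj₂ _ = refl

-- Embeds Fin (n + a) into Fin (n + b), keeping H's vertices and moving path vertices along φ;
-- the one path vertex outside the image of φ becomes the leaf.
module PathWidening {n : ℕ} (H : Graph n) (a b : ℕ) (φ : Fin a → Fin b) (new : Fin b)
  (φ-mono : ∀ {e e′} → toℕ e < toℕ e′ → toℕ (φ e) < toℕ (φ e′))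
  (φ≢new : ∀ e → φ e ≢ new)
  (new-or-φ : ∀ e′ → e′ ≡ new ⊎ ∃ λ e → e′ ≡ φ e) where

  ι : Fin (n + a) → Fin (n + b)
  ι z = [ _↑ˡ b , (λ e → n ↑ʳ φ e) ]′ (splitAt n z)

  ι-↑ˡ : ∀ x → ι (x ↑ˡ a) ≡ x ↑ˡ b
  ι-↑ˡ x rewrite splitAt-↑ˡ n x a = refl

  ι-↑ʳ : ∀ e → ι (n ↑ʳ e) ≡ n ↑ʳ φ e
  ι-↑ʳ e rewrite splitAt-↑ʳ n a e = refl

  leaf : Fin (n + b)
  leaf = n ↑ʳ new

  ι-mono : ∀ {i j} → toℕ i < toℕ j → toℕ (ι i) < toℕ (ι j)
  ι-mono {i} {j} lt with splitAt-view n i | splitAt-view n j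
  ... | inj₁ (x , refl) | inj₁ (y , refl) rewrite ι-↑ˡ x | ι-↑ˡ y | toℕ-↑ˡ x a | toℕ-↑ˡ y a | toℕ-↑ˡ x b | toℕ-↑ˡ y b = lt
  ... | inj₁ (x , refl) | inj₂ (e , refl) rewrite ι-↑ˡ x | ι-↑ʳ e = <-≤-trans (toℕ-↑ˡ-< b x) (n≤toℕ-↑ʳ n (φ e))
  ... | inj₂ (e , refl) | inj₁ (y , refl) = ⊥-elim (<-asym lt (<-≤-trans (toℕ-↑ˡ-< a y) (n≤toℕ-↑ʳ n e)))
  ... | inj₂ (e , refl) | inj₂ (e′ , refl) rewrite ι-↑ʳ e | ι-↑ʳ e′ | toℕ-↑ʳ n (φ e) | toℕ-↑ʳ n (φ e′) | toℕ-↑ʳ n e | toℕ-↑ʳ n e′ =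
    +-monoʳ-< n (φ-mono (+-cancelˡ-< n (toℕ e) (toℕ e′) lt))

  leaf≢ι : ∀ i → leaf ≢ ι i
  leaf≢ι i eq with splitAt-view n i
  ... | inj₁ (x , refl) rewrite ι-↑ˡ x = <-irrefl (sym (cong toℕ eq)) (<-≤-trans (toℕ-↑ˡ-< b x) (n≤toℕ-↑ʳ n new))
  ... | inj₂ (e , refl) rewrite ι-↑ʳ e =
    φ≢new e (sym (toℕ-injective (+-cancelˡ-≡ n (toℕ new) (toℕ (φ e)) (trans (sym (toℕ-↑ʳ n new)) (trans (cong toℕ eq) (toℕ-↑ʳ n (φ e)))))))

  leaf-or-ι : ∀ z → z ≡ leaf ⊎ ∃ λ i → z ≡ ι i
  leaf-or-ι z with splitAt-view n z
  ... | inj₁ (x , refl) = inj₂ (x ↑ˡ a , sym (ι-↑ˡ x))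
  ... | inj₂ (e′ , refl) with new-or-φ e′
  ...   | inj₁ refl       = inj₁ refl
  ...   | inj₂ (e , refl) = inj₂ (n ↑ʳ e , sym (ι-↑ʳ e))

  hAdj-ι : ∀ i j → hAdj {n} {b} H (ι i) (ι j) ≡ hAdj {n} {a} H i j
  hAdj-ι i j with splitAt-view n i | splitAt-view n j
  ... | inj₁ (x , refl) | inj₁ (y , refl) rewrite ι-↑ˡ x | ι-↑ˡ y = trans (hAdj-↑ˡ H b x y) (sym (hAdj-↑ˡ H a x y))
  ... | inj₁ (x , refl) | inj₂ (e , refl) rewrite ι-↑ˡ x | ι-↑ʳ e = trans (hAdj-↑ʳ-right H b _ (φ e)) (sym (hAdj-↑ʳ-right H a _ e))
  ... | inj₂ (e , refl) | inj₁ (y , refl) rewrite ι-↑ʳ e | ι-↑ˡ y = trans (hAdj-↑ʳ-left H b (φ e) _) (sym (hAdj-↑ʳ-left H a e _))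
  ... | inj₂ (e , refl) | inj₂ (e′ , refl) rewrite ι-↑ʳ e | ι-↑ʳ e′ = trans (hAdj-↑ʳ-left H b (φ e) _) (sym (hAdj-↑ʳ-left H a e _))

module Coalescence {n : ℕ} (H : Graph n) (v : Fin n) where

  module Positions (K : ℕ) (p : Fin (suc K)) where

    pos : Fin (n + K) → Maybe ℕ
    pos = pathPos {n} {suc K} v p

    pos-↑ˡ : ∀ x → pos (x ↑ˡ K) ≡ (if x == v then just (toℕ p) else nothing)
    pos-↑ˡ x rewrite splitAt-↑ˡ n x K = refl

    pos-↑ʳ : ∀ e → pos (n ↑ʳ e) ≡ just (if toℕ e <ᵇ toℕ p then toℕ e else suc (toℕ e))
    pos-↑ʳ e rewrite splitAt-↑ʳ n K e = refl

    pos-↑ˡ⁻ : ∀ x {q} → pos (x ↑ˡ K) ≡ just q → x ≡ v × q ≡ toℕ p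
    pos-↑ˡ⁻ x h rewrite pos-↑ˡ x with x == v in eq
    ... | true  = ==⇒≡ {i = x} (subst T (sym eq) tt) , sym (just-injective h)
    pos-↑ˡ⁻ x () | false

    pos-↑ʳ-≢ : ∀ e {q} → pos (n ↑ʳ e) ≡ just q → q ≢ toℕ p
    pos-↑ʳ-≢ e h rewrite pos-↑ʳ e with toℕ e <ᵇ toℕ p in eq
    ... | true  = λ q≡p → <-irrefl (trans (just-injective h) q≡p) (<ᵇ-true eq)
    ... | false = λ q≡p → subst T eq (<⇒<ᵇ (≤-reflexive (trans (just-injective h) q≡p)))

    pos-↑ʳ-injective : ∀ e e′ {q} → pos (n ↑ʳ e) ≡ just q → pos (n ↑ʳ e′) ≡ just q → e ≡ e′
    pos-↑ʳ-injective e e′ h h′ rewrite pos-↑ʳ e | pos-↑ʳ e′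
      with toℕ e <ᵇ toℕ p in eq | toℕ e′ <ᵇ toℕ p in eq′ | just-injective (trans h (sym h′))
    ... | true  | true  | same = toℕ-injective same
    ... | false | false | same = toℕ-injective (suc-injective same)
    ... | true  | false | same = ⊥-elim (subst T eq′ (<⇒<ᵇ (≤-<-trans (n≤1+n (toℕ e′)) (subst (_< toℕ p) same (<ᵇ-true eq)))))
    ... | false | true  | same = ⊥-elim (subst T eq (<⇒<ᵇ (≤-<-trans (n≤1+n (toℕ e)) (subst (_< toℕ p) (sym same) (<ᵇ-true eq′)))))

    pos-injective : ∀ z z′ {q} → pos z ≡ just q → pos z′ ≡ just q → z ≡ z′
    pos-injective z z′ h h′ with splitAt-view n z | splitAt-view n z′
    ... | inj₁ (x , refl) | inj₁ (x′ , refl) = cong (_↑ˡ K) (trans (proj₁ (pos-↑ˡ⁻ x h)) (sym (proj₁ (pos-↑ˡ⁻ x′ h′))))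
    ... | inj₁ (x , refl) | inj₂ (e , refl)  = ⊥-elim (pos-↑ʳ-≢ e h′ (proj₂ (pos-↑ˡ⁻ x h)))
    ... | inj₂ (e , refl) | inj₁ (x , refl)  = ⊥-elim (pos-↑ʳ-≢ e h (proj₂ (pos-↑ˡ⁻ x h′)))
    ... | inj₂ (e , refl) | inj₂ (e′ , refl) = cong (n ↑ʳ_) (pos-↑ʳ-injective e e′ h h′)

    pos-≤ : ∀ z q → pos z ≡ just q → q ≤ K
    pos-≤ z q h with splitAt-view n z
    ... | inj₂ (e , refl) rewrite pos-↑ʳ e with toℕ e <ᵇ toℕ p
    ...   | true  = subst (_≤ K) (just-injective h) (<⇒≤ (toℕ<n e))
    ...   | false = subst (_≤ K) (just-injective h) (toℕ<n e)
    pos-≤ z q h | inj₁ (x , refl) with pos-↑ˡ⁻ x h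
    ...   | _ , refl = s≤s⁻¹ (toℕ<n p)

  module Left (K : ℕ) = PathWidening H K (suc K) suc zero s≤s (λ _ ()) zero-or-suc

  pos-left-ι : ∀ K (p : Fin (suc K)) z →
    Positions.pos (suc K) (suc p) (Left.ι K z) ≡ Maybe.map suc (Positions.pos K p z)
  pos-left-ι K p z with splitAt-view n z
  ... | inj₁ (x , refl) rewrite Left.ι-↑ˡ K x | Positions.pos-↑ˡ (suc K) (suc p) x | Positions.pos-↑ˡ K p x with x == v
  ...   | true  = refl
  ...   | false = refl
  pos-left-ι K p z | inj₂ (e , refl) rewrite Left.ι-↑ʳ K e | Positions.pos-↑ʳ (suc K) (suc p) (suc e) | Positions.pos-↑ʳ K p e with toℕ e <ᵇ toℕ p
  ...   | true  = refl
  ...   | false = refl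

  -- Prepending a vertex at position 0 shifts every position, and v's with them.
  extension-left : ∀ K (p : Fin (suc K)) u → Positions.pos K p u ≡ just 0 →
                   PendantExtension (coalesce H v (suc K) p) (coalesce H v (suc (suc K)) (suc p))
  extension-left K p u pos-u = record
    { ι = ι ; ι-mono = ι-mono ; leaf = leaf ; anchor = u ; leaf≢ι = leaf≢ι ; leaf-or-ι = leaf-or-ι
    ; adj-ι-ι       = λ i j → cong₂ _∨_ (hAdj-ι i j) (trans (cong₂ pathAdj (pos-left-ι K p i) (pos-left-ι K p j)) (pathAdj-map-suc (pos i) (pos j)))
    ; adj-leaf-ι    = λ j → trans (cong₂ _∨_ (hAdj-↑ʳ-left H (suc K) zero (ι j)) (cong₂ pathAdj (pos′-↑ʳ zero) (pos-left-ι K p j)))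
                                  (trans (pathAdj-0-suc (pos j)) (isJust0-pos j))
    ; adj-ι-leaf    = λ j → trans (cong₂ _∨_ (hAdj-↑ʳ-right H (suc K) (ι j) zero) (cong₂ pathAdj (pos-left-ι K p j) (pos′-↑ʳ zero)))
                                  (trans (pathAdj-suc-0 (pos j)) (isJust0-pos j))
    ; adj-leaf-leaf = cong₂ _∨_ (hAdj-↑ʳ-left H (suc K) zero leaf) (cong₂ pathAdj (pos′-↑ʳ zero) (pos′-↑ʳ zero))
    }
    where
    open Left K
    open Positions K p
    open Positions (suc K) (suc p) using () renaming (pos-↑ʳ to pos′-↑ʳ)
    isJust0-pos : ∀ j → isJust0 (pos j) ≡ (j == u)
    isJust0-pos j = T-ext (λ h → ≡⇒== {i = j} (pos-injective j u (isJust0⁻ (pos j) h) pos-u))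
                          (λ h → subst (T ∘ isJust0 ∘ pos) (sym (==⇒≡ {i = j} h)) (subst (T ∘ isJust0) (sym pos-u) tt))

  <ᵇ-zero : ∀ x → (x <ᵇ 0) ≡ false
  <ᵇ-zero zero    = refl
  <ᵇ-zero (suc _) = refl

  inject₁-mono : ∀ {K} {e e′ : Fin K} → toℕ e < toℕ e′ → toℕ (inject₁ e) < toℕ (inject₁ e′)
  inject₁-mono {e = e} {e′} = subst₂ _<_ (sym (toℕ-inject₁ e)) (sym (toℕ-inject₁ e′))

  inject₁≢fromℕ : ∀ {K} (e : Fin K) → inject₁ e ≢ fromℕ K
  inject₁≢fromℕ {K} e eq = <-irrefl (trans (sym (toℕ-inject₁ e)) (trans (cong toℕ eq) (toℕ-fromℕ K))) (toℕ<n e)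

  module Right (K : ℕ) = PathWidening H K (suc K) inject₁ (fromℕ K) inject₁-mono inject₁≢fromℕ (fromℕ-or-inject₁ K)

  pos-right-ι : ∀ K z → Positions.pos (suc K) zero (Right.ι K z) ≡ Positions.pos K zero z
  pos-right-ι K z with splitAt-view n z
  ... | inj₁ (x , refl) rewrite Right.ι-↑ˡ K x | Positions.pos-↑ˡ (suc K) zero x | Positions.pos-↑ˡ K zero x = refl
  ... | inj₂ (e , refl) rewrite Right.ι-↑ʳ K e | Positions.pos-↑ʳ (suc K) zero (inject₁ e) | Positions.pos-↑ʳ K zero e | toℕ-inject₁ e = refl

  pos-right-leaf : ∀ K → Positions.pos (suc K) zero (Right.leaf K) ≡ just (suc K)
  pos-right-leaf K rewrite Positions.pos-↑ʳ (suc K) zero (fromℕ K) | <ᵇ-zero (toℕ (fromℕ K)) | toℕ-fromℕ K = refl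

  extension-right : ∀ K u → Positions.pos K zero u ≡ just K →
                    PendantExtension (coalesce H v (suc K) zero) (coalesce H v (suc (suc K)) zero)
  extension-right K u pos-u = record
    { ι = ι ; ι-mono = ι-mono ; leaf = leaf ; anchor = u ; leaf≢ι = leaf≢ι ; leaf-or-ι = leaf-or-ι
    ; adj-ι-ι       = λ i j → cong₂ _∨_ (hAdj-ι i j) (cong₂ pathAdj (pos-right-ι K i) (pos-right-ι K j))
    ; adj-leaf-ι    = λ j → trans (cong₂ _∨_ (hAdj-↑ʳ-left H (suc K) (fromℕ K) (ι j)) (cong₂ pathAdj (pos-right-leaf K) (pos-right-ι K j)))
                                  (pathAdj-top-pos j)
    ; adj-ι-leaf    = λ j → trans (cong₂ _∨_ (hAdj-↑ʳ-right H (suc K) (ι j) (fromℕ K)) (cong₂ pathAdj (pos-right-ι K j) (pos-right-leaf K)))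
                                  (pathAdj-pos-top j)
    ; adj-leaf-leaf = trans (cong₂ _∨_ (hAdj-↑ʳ-left H (suc K) (fromℕ K) leaf) (cong₂ pathAdj (pos-right-leaf K) (pos-right-leaf K))) (pathAdj-irrefl (suc K))
    }
    where
    open Right K
    open Positions K zero
    pos-u⁻ : ∀ j → T (j == u) → pos j ≡ just K
    pos-u⁻ j h = trans (cong pos (==⇒≡ {i = j} h)) pos-u
    pathAdj-top-pos : ∀ j → pathAdj (just (suc K)) (pos j) ≡ (j == u)
    pathAdj-top-pos j = T-ext (λ h → ≡⇒== {i = j} (pos-injective j u (pathAdj-top⁻ K (pos j) (pos-≤ j) h) pos-u))
      (λ h → subst (T ∘ pathAdj (just (suc K))) (sym (pos-u⁻ j h)) (pathAdj-just⁺ (suc K) K (inj₂ refl)))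
    pathAdj-pos-top : ∀ j → pathAdj (pos j) (just (suc K)) ≡ (j == u)
    pathAdj-pos-top j = T-ext (λ h → ≡⇒== {i = j} (pos-injective j u (pathAdj-topʳ⁻ K (pos j) (pos-≤ j) h) pos-u))
      (λ h → subst (λ a → T (pathAdj a (just (suc K)))) (sym (pos-u⁻ j h)) (pathAdj-just⁺ K (suc K) (inj₁ refl)))

  extension-base : ∀ (p : Fin 2) → PendantExtension H (coalesce H v 2 p)
  extension-base p = record
    { ι = _↑ˡ 1 ; ι-mono = λ {i} {j} → subst₂ _<_ (sym (toℕ-↑ˡ i 1)) (sym (toℕ-↑ˡ j 1))
    ; leaf = n ↑ʳ zero ; anchor = v
    ; leaf≢ι = λ i eq → <-irrefl (sym (cong toℕ eq)) (<-≤-trans (toℕ-↑ˡ-< 1 i) (n≤toℕ-↑ʳ n {1} zero))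
    ; leaf-or-ι = leaf-or-ι
    ; adj-ι-ι = adj-ι-ι
    ; adj-leaf-ι = adj-leaf-ι p
    ; adj-ι-leaf = adj-ι-leaf p
    ; adj-leaf-leaf = trans (cong₂ _∨_ (hAdj-↑ʳ-left H 1 zero (n ↑ʳ zero)) (cong₂ pathAdj (pos-↑ʳ zero) (pos-↑ʳ zero)))
                            (pathAdj-irrefl (if 0 <ᵇ toℕ p then 0 else 1))
    }
    where
    open Positions 1 p
    leaf-or-ι : ∀ z → z ≡ n ↑ʳ zero ⊎ ∃ λ i → z ≡ i ↑ˡ 1
    leaf-or-ι z with splitAt-view n z
    ... | inj₁ (x , e)    = inj₂ (x , e)
    ... | inj₂ (zero , e) = inj₁ e
    adj-ι-ι : ∀ i j → coalesce H v 2 p (i ↑ˡ 1) (j ↑ˡ 1) ≡ H i j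
    adj-ι-ι i j rewrite hAdj-↑ˡ H 1 i j | pos-↑ˡ i | pos-↑ˡ j with i == v | j == v
    ... | true  | true  = trans (cong (H i j ∨_) (pathAdj-irrefl (toℕ p))) (∨-identityʳ _)
    ... | true  | false = ∨-identityʳ _
    ... | false | true  = ∨-identityʳ _
    ... | false | false = ∨-identityʳ _
    adj-leaf-ι : ∀ (p : Fin 2) j → coalesce H v 2 p (n ↑ʳ zero) (j ↑ˡ 1) ≡ (j == v)
    adj-leaf-ι p j rewrite hAdj-↑ʳ-left H 1 zero (j ↑ˡ 1) | Positions.pos-↑ʳ 1 p zero | Positions.pos-↑ˡ 1 p j with j == v
    adj-leaf-ι zero       j | true  = refl
    adj-leaf-ι (suc zero) j | true  = refl
    adj-leaf-ι zero       j | false = refl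
    adj-leaf-ι (suc zero) j | false = refl
    adj-ι-leaf : ∀ (p : Fin 2) j → coalesce H v 2 p (j ↑ˡ 1) (n ↑ʳ zero) ≡ (j == v)
    adj-ι-leaf p j rewrite hAdj-↑ʳ-right H 1 (j ↑ˡ 1) zero | Positions.pos-↑ʳ 1 p zero | Positions.pos-↑ˡ 1 p j with j == v
    adj-ι-leaf zero       j | true  = refl
    adj-ι-leaf (suc zero) j | true  = refl
    adj-ι-leaf zero       j | false = refl
    adj-ι-leaf (suc zero) j | false = refl

module _ {n : ℕ} (H : Graph n) (simple : IsSimple H) (v : Fin n) where
  open PathAttachment H v
  open Coalescence H v

  AttachedCoalescence : (K : ℕ) (p : Fin (suc (suc K))) → Set
  AttachedCoalescence K p = ∃ λ x → ∃ λ y → pos x ≡ just 0 × pos y ≡ just (suc K)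
                          × Attached (coalesce H v (suc (suc K)) p) x y (toℕ p) (suc K ∸ toℕ p)
    where open Positions (suc K) p

  coalesce-attached : ∀ K p → AttachedCoalescence K p
  coalesce-attached zero zero =
    v ↑ˡ 1 , n ↑ʳ zero , pos-v , Positions.pos-↑ʳ 1 zero zero , extend-right (extension-base zero) (attached-trivial simple)
    where
    pos-v : Positions.pos 1 zero (v ↑ˡ 1) ≡ just 0
    pos-v rewrite Positions.pos-↑ˡ 1 zero v | ==-refl v = refl
  coalesce-attached zero (suc zero) =
    n ↑ʳ zero , v ↑ˡ 1 , Positions.pos-↑ʳ 1 (suc zero) zero , pos-v , extend-left (extension-base (suc zero)) (attached-trivial simple)
    where
    pos-v : Positions.pos 1 (suc zero) (v ↑ˡ 1) ≡ just 1
    pos-v rewrite Positions.pos-↑ˡ 1 (suc zero) v | ==-refl v = refl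
  coalesce-attached (suc K) zero with coalesce-attached K zero
  ... | x , y , pos-x , pos-y , A =
    Right.ι (suc K) x , Right.leaf (suc K) , trans (pos-right-ι (suc K) x) pos-x , pos-right-leaf (suc K) ,
    extend-right (extension-right (suc K) y pos-y) A
  coalesce-attached (suc K) (suc p) with coalesce-attached K p
  ... | x , y , pos-x , pos-y , A =
    Left.leaf (suc K) , Left.ι (suc K) y , Positions.pos-↑ʳ (suc (suc K)) (suc p) zero , trans (pos-left-ι (suc K) p y) (cong (Maybe.map suc) pos-y) ,
    extend-left (extension-left (suc K) p x pos-x) A

-- The ring solver does not handle ℕ exponentiation, which is why the invariants use products.
^-two : ∀ a → a ^ 2 ≡ a * a
^-two a = cong (a *_) (*-identityʳ a)

^-three : ∀ a → a ^ 3 ≡ a * a * a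
^-three a = trans (cong (a *_) (^-two a)) (sym (*-assoc a a a))

lemma3p8 : (n : ℕ) (H : Graph n) → IsSimple H → Connected H →
    (v : Fin n) (k : ℕ) → 2 ≤ k → (p : Fin k) →
    let G = coalesce H v k p
        k₁ = toℕ p
        k₂ = (k ∸ 1) ∸ toℕ p
    in 3 * dFd G ≡ 3 * dFd H + 12 * (k ∸ 1) * dfv H v
         + τ H * (4 * (k ∸ 1) ^ 3 + 2 * (k ∸ 1) + 12 * numEdges H * (k₁ ^ 2 + k₂ ^ 2))
lemma3p8 n H simple _ v (suc (suc K)) (s≤s (s≤s z≤n)) p with coalesce-attached H simple v K p
... | _ , _ , _ , _ , A =
  trans (PathAttachment.Attached.dFd-eq A)
  (trans (cong₂ (λ c s → 3 * dFd H + 12 * (k₁ + k₂) * dfv H v + τ H * (4 * c + 2 * (k₁ + k₂) + 12 * numEdges H * s))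
                (sym (^-three (k₁ + k₂))) (sym (cong₂ _+_ (^-two k₁) (^-two k₂))))
         (cong (λ c → 3 * dFd H + 12 * c * dfv H v + τ H * (4 * c ^ 3 + 2 * c + 12 * numEdges H * (k₁ ^ 2 + k₂ ^ 2)))
               (m+[n∸m]≡n (s≤s⁻¹ (toℕ<n p)))))
  where
  k₁ k₂ : ℕ
  k₁ = toℕ p
  k₂ = suc K ∸ toℕ p
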